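{- Let $\mathcal{P}_1,\ldots,\mathcal{P}_m \subset \mathbb{R}^N$ be lattice polytopes. Then: (1) The Cayley sum $\mathcal{P}_1*\cdots*\mathcal{P}_m$ has the integer decomposition property if and only if each $\mathcal{P}_i$ has the integer decomposition property and, for all nonnegative integers $a_1,\ldots,a_m$, the tuple $(a_1\mathcal{P}_1,\ldots,a_m\mathcal{P}_m)$ is IDP. In this case, for all nonnegative integers $a_1,\ldots,a_m$, the Minkowski sum $\sum_{i=1}^m a_i\mathcal{P}_i$ has the integer decomposition property. (2) If $\mathcal{P}_1*\cdots*\mathcal{P}_m$ is level of index $m$, then $\mathcal{P}_1+\cdots+\mathcal{P}_m$ is level of index $1$.
   Context: A lattice polytope is a convex polytope all of whose vertices lie in $\mathbb{Z}^N$. For $n\ge 0$, $n\mathcal{P}=\{n\mathbf{x}:\mathbf{x}\in\mathcal{P}\}$. A lattice polytope $\mathcal{P}\subset\mathbb{R}^N$ has the integer decomposition property (is IDP) if for every integer $n\ge1$, $n\mathcal{P}\cap\mathbb{Z}^N=((n-1)\mathcal{P}\cap\mathbb{Z}^N)+(\mathcal{P}\cap\mathbb{Z}^N)$. The Minkowski sum is $\mathcal{P}_1+\cdots+\mathcal{P}_m=\{\mathbf{a}_1+\cdots+\mathbf{a}_m:\mathbf{a}_i\in\mathcal{P}_i\}$. The Cayley sum is $\mathcal{P}_1*\cdots*\mathcal{P}_m=\mathrm{conv}(\{\mathbf{e}_1\}\times\mathcal{P}_1\cup\cdots\cup\{\mathbf{e}_m\}\times\mathcal{P}_m)\subset\mathbb{R}^m\times\mathbb{R}^N$,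 where $\mathbf{e}_1,\ldots,\mathbf{e}_m$ are the standard unit vectors of $\mathbb{R}^m$. A tuple $(\mathcal{Q}_1,\ldots,\mathcal{Q}_m)$ of lattice polytopes in $\mathbb{R}^N$ is IDP if for every nonempty $I\subset\{1,\ldots,m\}$, $(\sum_{i\in I}\mathcal{Q}_i)\cap\mathbb{Z}^N=\sum_{i\in I}(\mathcal{Q}_i\cap\mathbb{Z}^N)$. For $A\subset\mathbb{R}^N$, $\mathrm{int}(A)$ denotes the relative interior of $A$ in its affine span. A lattice polytope $\mathcal{P}\subset\mathbb{R}^N$ is level of index $r$ if $r=\min\{t\in\mathbb{Z}_{>0}:\mathrm{int}(t\mathcal{P})\cap\mathbb{Z}^N\neq\emptyset\}$ and for every integer $n\ge r$, $\mathrm{int}(n\mathcal{P})\cap\mathbb{Z}^N=(\mathrm{int}(r\mathcal{P})\cap\mathbb{Z}^N)+((n-r)\mathcal{P}\cap\mathbb{Z}^N)$.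
   Formalization: The polytopes, their dilations, Minkowski sums, the Cayley sum and relative interiors consist of points with rational coordinates, in ℚ^N rather than $\mathbb{R}^N$. -}

module Defs where

open import Data.Nat as ℕ using (ℕ; zero; suc; _∸_)
open import Data.Integer as ℤ using (ℤ; +_)
open import Data.Rational using (ℚ; _+_; _*_; _-_; _≤_; _<_; 0ℚ; 1ℚ; _/_)
open import Data.Fin using (Fin; zero; suc; _≟_)
open import Data.List using (List; []; _∷_; length; zipWith; map; concatMap; foldr; allFin)
open import Data.List.NonEmpty using (List⁺; toList)
open import Data.List.Relation.Unary.All using (All)
open import Data.List.Membership.Propositional using (_∈_)
open import Data.Vec.Functional using (Vector; _++_)
open import Data.Vec.Functional as VF using ()
open import Data.Bool using (Bool; true; false)
open import Data.Product using (Σ; ∃; ∃-syntax; _×_)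
open import Relation.Nullary using (¬_; yes; no)
open import Relation.Binary.PropositionalEquality using (_≡_)
open import Function.Bundles using (_⇔_)

Pt : ℕ → Set
Pt N = Fin N → ℚ

ZPt : ℕ → Set
ZPt N = Fin N → ℤ

ι : ∀ {N} → ZPt N → Pt N
ι z j = z j / 1

-- a (rational-point) subset of R^N
RSet : ℕ → Set₁
RSet N = Pt N → Set

ZSet : ℕ → Set₁
ZSet N = ZPt N → Set

sumℚ : List ℚ → ℚ
sumℚ = foldr _+_ 0ℚ

conv : ∀ {N} → List (ZPt N) → RSet N
conv {N} V x = Σ (List ℚ) λ cs →
  length cs ≡ length V × All (0ℚ ≤_) cs × sumℚ cs ≡ 1ℚ ×
  (∀ j → x j ≡ sumℚ (zipWith (λ c v → c * (v j / 1)) cs V))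

Poly : ℕ → Set
Poly N = List⁺ (ZPt N)

⟦_⟧ : ∀ {N} → Poly N → RSet N
⟦ P ⟧ = conv (toList P)

scale : ∀ {N} → ℕ → RSet N → RSet N
scale n S y = ∃[ x ] (S x × (∀ j → y j ≡ (+ n / 1) * x j))

LP : ∀ {N} → RSet N → ZSet N
LP S z = S (ι z)

_⊕_ : ∀ {N} → RSet N → RSet N → RSet N
(A ⊕ B) x = ∃[ y ] ∃[ z ] (A y × B z × (∀ j → x j ≡ y j + z j))

_⊕ℤ_ : ∀ {N} → ZSet N → ZSet N → ZSet N
(A ⊕ℤ B) x = ∃[ y ] ∃[ z ] (A y × B z × (∀ j → x j ≡ y j ℤ.+ z j))

zeroSet : ∀ {N} → RSet N
zeroSet x = ∀ j → x j ≡ 0ℚ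

zeroZSet : ∀ {N} → ZSet N
zeroZSet x = ∀ j → x j ≡ + 0

ΣR : ∀ {N m} → (Fin m → RSet N) → RSet N
ΣR {m = zero} Q = zeroSet
ΣR {m = suc m} Q = Q zero ⊕ ΣR (λ i → Q (suc i))

ΣZ : ∀ {N m} → (Fin m → ZSet N) → ZSet N
ΣZ {m = zero} Q = zeroZSet
ΣZ {m = suc m} Q = Q zero ⊕ℤ ΣZ (λ i → Q (suc i))

_≐_ : ∀ {N} → ZSet N → ZSet N → Set
A ≐ B = ∀ z → A z ⇔ B z

-- relative interior (in the affine span) of a convex set S:
-- x ∈ S and for every y ∈ S the segment from y through x extends beyond x within S
relint : ∀ {N} → RSet N → RSet N
relint S x = S x × (∀ y → S y → ∃[ ε ] (0ℚ < ε × S (λ j → x j + ε * (x j - y j))))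

IDP : ∀ {N} → RSet N → Set
IDP P = ∀ (n : ℕ) → 1 ℕ.≤ n →
  LP (scale n P) ≐ (LP (scale (n ∸ 1) P) ⊕ℤ LP P)

restrict : ∀ {N m} → (Fin m → Bool) → (Fin m → RSet N) → Fin m → RSet N
restrict I Q i with I i
... | true = Q i
... | false = zeroSet

restrictℤ : ∀ {N m} → (Fin m → Bool) → (Fin m → ZSet N) → Fin m → ZSet N
restrictℤ I Q i with I i
... | true = Q i
... | false = zeroZSet

TupleIDP : ∀ {N m} → (Fin m → RSet N) → Set
TupleIDP {m = m} Q = ∀ (I : Fin m → Bool) → (∃[ i ] I i ≡ true) →
  LP (ΣR (restrict I Q)) ≐ ΣZ (restrictℤ I (λ i → LP (Q i)))

Level : ∀ {N} → RSet N → ℕ → Set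
Level P r =
  (1 ℕ.≤ r) ×
  (∃[ z ] LP (relint (scale r P)) z) ×
  (∀ t → 1 ℕ.≤ t → t ℕ.< r → ∀ z → ¬ LP (relint (scale t P)) z) ×
  (∀ n → r ℕ.≤ n → LP (relint (scale n P)) ≐ (LP (relint (scale r P)) ⊕ℤ LP (scale (n ∸ r) P)))

unit : ∀ {m} → Fin m → ZPt m
unit i j with i ≟ j
... | yes _ = + 1
... | no _ = + 0

cayleyVerts : ∀ {N m} → (Fin m → Poly N) → List (ZPt (m ℕ.+ N))
cayleyVerts {m = m} P = concatMap (λ i → map (λ v → unit i ++ v) (toList (P i))) (allFin m)

Cayley : ∀ {N m} → (Fin m → Poly N) → RSet (m ℕ.+ N)
Cayley P = conv (cayleyVerts P)

-- A point of t · conv V is encoded by coefficients on V.  The Cayley sum C = P₁ * ⋯ * Pₘ is the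
-- convex hull of the blocks {eᵢ} × Pᵢ, so a point of t C has heads a ∈ ℚᵐ with Σ aᵢ = t and its tail
-- lies in a₁P₁ + ⋯ + aₘPₘ; in particular the lattice points of C are the (eⱼ, q) with q a lattice
-- point of Pⱼ.  If C is IDP, a lattice point of n C is a sum of n such points, and grouping them by j
-- splits a lattice point of Σ aᵢPᵢ, lifted to heads a, into lattice points of the aᵢPᵢ; restricted to
-- the face of n C over n eⱼ the same decomposition shows that Pⱼ is IDP.  Conversely, IDP of the Pᵢ
-- and of the tuple (a₁P₁, …, aₘPₘ) write a lattice point of n C with heads a as a sum of n lattice
-- points of C.  IDP of Σ aᵢPᵢ follows by splitting every summand of k (Σ aᵢPᵢ) = Σ (k aᵢ) Pᵢ.  For
-- levelness, an interior lattice point of m C has positive integer heads summing to m, all equal to 1,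
-- so its tail is an interior lattice point of P₁ + ⋯ + Pₘ; decomposing the lift (n, …, n, z) of an
-- interior lattice point z of n (P₁ + ⋯ + Pₘ) in n m C gives the decomposition for index 1.

module Submission where

open import Defs
open import Algebra.Bundles using (Ring; Semiring; CommutativeMonoid; AbelianGroup)
import Algebra.Properties.Semiring.Sum as SemiringSum
open import Data.Bool using (Bool; true; false; if_then_else_)
open import Data.Fin using (Fin; zero; suc; _≟_; _↑ˡ_; _↑ʳ_; splitAt)
open import Data.Fin.Properties using (join-splitAt; punchInᵢ≢i; suc-injective)
open import Data.Integer as ℤ using (ℤ; -[1+_])
import Data.Integer.Properties as ℤP
open import Algebra.Properties.Group (AbelianGroup.group ℤP.+-0-abelianGroup) using () renaming (∙-cancelʳ to ℤ-+-cancelʳ)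
open import Data.List using (List; []; _∷_; _++_; length; zipWith; map; concat; tabulate)
open import Data.List.NonEmpty as List⁺ using (toList)
open import Data.List.Properties using (map-tabulate)
open import Data.List.Relation.Unary.All using (All; []; _∷_)
open import Data.Nat as ℕ using (ℕ; zero; suc; z≤n; s≤s)
open import Data.Nat.Coprimality using (1-coprimeTo) renaming (sym to coprime-sym)
import Data.Nat.Properties as ℕP
open import Data.Product using (Σ; ∃; ∃-syntax; _×_; _,_; proj₁; proj₂)
open import Data.Rational using (ℚ; mkℚ; _+_; _*_; _-_; -_; _≤_; _<_; _⊓_; 0ℚ; 1ℚ; _/_; ↥_; 1/_; *≤*; positive; nonNegative; >-nonZero)
open import Data.Rational.Properties hiding (_≟_)
open import Data.Rational.Solver using (module +-*-Solver)
open import Data.Sum using (inj₁; inj₂)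
open import Data.Unit using (⊤; tt)
open import Data.Vec.Functional as Vector using (Vector; removeAt)
open import Data.Vec.Functional.Properties using (lookup-++ˡ; lookup-++ʳ)
open import Function.Bundles using (_⇔_; mk⇔; Equivalence)
open import Relation.Nullary using (Dec; yes; no; contradiction)
open import Relation.Unary using (_⊆_)
open import Relation.Binary.PropositionalEquality using (_≡_; _≢_; _≗_; refl; sym; trans; cong; cong₂; subst; module ≡-Reasoning)

open +-*-Solver using (solve; _:=_; _:+_; _:*_; _:-_; :-_; con)

module ℚ∑ = SemiringSum (Ring.semiring +-*-ring)
module ℤ∑ = SemiringSum ℤP.+-*-semiring
module ℕ∑ = SemiringSum ℕP.+-*-semiring

private variable
  N m : ℕ

ιℤ : ℤ → ℚ
ιℤ i = i / 1

ιℕ : ℕ → ℚ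
ιℕ n = ιℤ (ℤ.+ n)

-- `i / 1` is stuck for a variable `i`; its normal form `mkℚ i 0 _` lets `_+_`, `_*_` and `_≤_` compute.
private
  ιℤ≡mkℚ : ∀ i → ιℤ i ≡ mkℚ i 0 (coprime-sym (1-coprimeTo _))
  ιℤ≡mkℚ (ℤ.+ n) = normalize-coprime {n} {0} (coprime-sym (1-coprimeTo _))
  ιℤ≡mkℚ -[1+ n ] = cong -_ (normalize-coprime {suc n} {0} (coprime-sym (1-coprimeTo _)))

ιℤ-+ : ∀ i j → ιℤ (i ℤ.+ j) ≡ ιℤ i + ιℤ j
ιℤ-+ i j rewrite ιℤ≡mkℚ i | ιℤ≡mkℚ j | ℤP.*-identityʳ i | ℤP.*-identityʳ j = refl

ιℤ-* : ∀ i j → ιℤ (i ℤ.* j) ≡ ιℤ i * ιℤ j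
ιℤ-* i j rewrite ιℤ≡mkℚ i | ιℤ≡mkℚ j = refl

ιℤ-injective : ∀ {i j} → ιℤ i ≡ ιℤ j → i ≡ j
ιℤ-injective {i} {j} e rewrite ιℤ≡mkℚ i | ιℤ≡mkℚ j = cong ↥_ e

ιℤ-cancel-≤ : ∀ {i j} → ιℤ i ≤ ιℤ j → i ℤ.≤ j
ιℤ-cancel-≤ {i} {j} i≤j rewrite ιℤ≡mkℚ i | ιℤ≡mkℚ j with i≤j
... | *≤* i*1≤j*1 rewrite ℤP.*-identityʳ i | ℤP.*-identityʳ j = i*1≤j*1

ιℕ-+ : ∀ m n → ιℕ (m ℕ.+ n) ≡ ιℕ m + ιℕ n
ιℕ-+ m n = ιℤ-+ (ℤ.+ m) (ℤ.+ n)

ιℕ-* : ∀ m n → ιℕ (m ℕ.* n) ≡ ιℕ m * ιℕ n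
ιℕ-* m n = trans (cong ιℤ (ℤP.pos-* m n)) (ιℤ-* (ℤ.+ m) (ℤ.+ n))

ιℕ-injective : ∀ {m n} → ιℕ m ≡ ιℕ n → m ≡ n
ιℕ-injective e = ℤP.+-injective (ιℤ-injective e)

ιℕ-nonNeg : ∀ n → 0ℚ ≤ ιℕ n
ιℕ-nonNeg n = nonNegative⁻¹ (ιℕ n) {{normalize-nonNeg n 1}}

ιℕ-pos : ∀ n → 0ℚ < ιℕ (suc n)
ιℕ-pos n = positive⁻¹ (ιℕ (suc n)) {{normalize-pos (suc n) 1}}

ιℕ-pos⁻¹ : ∀ n → 0ℚ < ιℕ n → 1 ℕ.≤ n
ιℕ-pos⁻¹ zero 0<0 = contradiction 0<0 (<-irrefl refl)
ιℕ-pos⁻¹ (suc n) _ = s≤s z≤n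

ιℕ-sum : ∀ {m} (a : Fin m → ℕ) → ιℕ (ℕ∑.sum a) ≡ ℚ∑.sum (λ i → ιℕ (a i))
ιℕ-sum {zero} a = refl
ιℕ-sum {suc m} a = trans (ιℕ-+ (a zero) _) (cong (ιℕ (a zero) +_) (ιℕ-sum (λ i → a (suc i))))

ιℤ-sum : ∀ {m} (f : Fin m → ℤ) → ιℤ (ℤ∑.sum f) ≡ ℚ∑.sum (λ i → ιℤ (f i))
ιℤ-sum {zero} f = refl
ιℤ-sum {suc m} f = trans (ιℤ-+ (f zero) _) (cong (ιℤ (f zero) +_) (ιℤ-sum (λ i → f (suc i))))

nonNeg-ιℤ⇒ℕ : ∀ i → 0ℚ ≤ ιℤ i → ∃[ n ] i ≡ ℤ.+ n
nonNeg-ιℤ⇒ℕ (ℤ.+ n) _ = n , refl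
nonNeg-ιℤ⇒ℕ -[1+ n ] 0≤i with ιℤ-cancel-≤ {ℤ.+ 0} { -[1+ n ]} 0≤i
... | ()

nonNeg-* : ∀ {p q} → 0ℚ ≤ p → 0ℚ ≤ q → 0ℚ ≤ p * q
nonNeg-* {p} {q} 0≤p 0≤q = subst (_≤ p * q) (*-zeroʳ p) (*-monoˡ-≤-nonNeg p {{nonNegative 0≤p}} 0≤q)

pos-* : ∀ {p q} → 0ℚ < p → 0ℚ < q → 0ℚ < p * q
pos-* {p} {q} 0<p 0<q = positive⁻¹ (p * q) {{pos*pos⇒pos p {{positive 0<p}} q {{positive 0<q}}}}

p≤p+q : ∀ {p q} → 0ℚ ≤ q → p ≤ p + q
p≤p+q {p} 0≤q = subst (_≤ p + _) (+-identityʳ p) (+-monoʳ-≤ p 0≤q)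

p≤q⇒0≤q-p : ∀ {p q} → p ≤ q → 0ℚ ≤ q - p
p≤q⇒0≤q-p {p} {q} p≤q = subst (_≤ q - p) (+-inverseʳ p) (+-monoˡ-≤ (- p) p≤q)

nonNeg-+≡0 : ∀ {p q} → 0ℚ ≤ p → 0ℚ ≤ q → p + q ≡ 0ℚ → p ≡ 0ℚ × q ≡ 0ℚ
nonNeg-+≡0 {p} {q} 0≤p 0≤q p+q≡0 =
  ≤-antisym (subst (p ≤_) p+q≡0 (p≤p+q 0≤q)) 0≤p ,
  ≤-antisym (subst (q ≤_) (trans (+-comm q p) p+q≡0) (p≤p+q 0≤p)) 0≤q

pos-inverse : ∀ {p} → 0ℚ < p → ∃[ q ] 0ℚ < q × p * q ≡ 1ℚ
pos-inverse {p} 0<p = (1/ p) {{>-nonZero 0<p}} ,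
  positive⁻¹ _ {{1/pos⇒pos p {{positive 0<p}}}} , *-inverseʳ p {{>-nonZero 0<p}}

pos-⊓ : ∀ {p q} → 0ℚ < p → 0ℚ < q → 0ℚ < p ⊓ q
pos-⊓ {p} {q} 0<p 0<q with ≤-total p q
... | inj₁ p≤q = subst (0ℚ <_) (sym (p≤q⇒p⊓q≡p p≤q)) 0<p
... | inj₂ q≤p = subst (0ℚ <_) (sym (p≥q⇒p⊓q≡q q≤p)) 0<q

0<1 : 0ℚ < 1ℚ
0<1 = ιℕ-pos 0

module _ {c ℓ} (M : CommutativeMonoid c ℓ) where

  open CommutativeMonoid M using (Carrier; _≈_; _∙_; ε; ∙-congˡ; identityʳ) renaming (trans to ≈-trans)
  open import Algebra.Properties.CommutativeMonoid.Sum M using (sum; sum-remove; sum-cong-≋; sum-replicate-zero)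
  open import Relation.Binary.Reasoning.Setoid (CommutativeMonoid.setoid M)

  sum-single : ∀ {m} (f : Fin m → Carrier) j → (∀ i → i ≢ j → f i ≈ ε) → sum f ≈ f j
  sum-single {suc m} f j off = begin
    sum f                     ≈⟨ sum-remove {i = j} f ⟩
    f j ∙ sum (removeAt f j)  ≈⟨ ∙-congˡ (≈-trans (sum-cong-≋ (λ k → off _ (punchInᵢ≢i j k))) (sum-replicate-zero m)) ⟩
    f j ∙ ε                   ≈⟨ identityʳ (f j) ⟩
    f j                       ∎

ℚ∑-single : ∀ {m} (f : Fin m → ℚ) j → (∀ i → i ≢ j → f i ≡ 0ℚ) → ℚ∑.sum f ≡ f j
ℚ∑-single = sum-single (Semiring.+-commutativeMonoid (Ring.semiring +-*-ring))

ℤ∑-single : ∀ {m} (f : Fin m → ℤ) j → (∀ i → i ≢ j → f i ≡ ℤ.+ 0) → ℤ∑.sum f ≡ f j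
ℤ∑-single = sum-single ℤP.+-0-commutativeMonoid

ℕ∑-const : ∀ m n → ℕ∑.sum {m} (λ _ → n) ≡ m ℕ.* n
ℕ∑-const zero n = refl
ℕ∑-const (suc m) n = cong (n ℕ.+_) (ℕ∑-const m n)

ℕ∑-pos : ∀ {m} (a : Fin m → ℕ) → 1 ℕ.≤ ℕ∑.sum a → ∃[ j ] 1 ℕ.≤ a j
ℕ∑-pos {suc m} a 1≤Σa with a zero in eq
... | suc _ = zero , subst (1 ℕ.≤_) (sym eq) (s≤s z≤n)
... | zero = let j , 1≤aj = ℕ∑-pos (λ i → a (suc i)) 1≤Σa in suc j , 1≤aj

ℕ∑≥m : ∀ {m} (a : Fin m → ℕ) → (∀ i → 1 ℕ.≤ a i) → m ℕ.≤ ℕ∑.sum a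
ℕ∑≥m {zero} a _ = z≤n
ℕ∑≥m {suc m} a pos = ℕP.+-mono-≤ (pos zero) (ℕ∑≥m (λ i → a (suc i)) (λ i → pos (suc i)))

ℕ∑≡m⇒all-one : ∀ {m} (a : Fin m → ℕ) → (∀ i → 1 ℕ.≤ a i) → ℕ∑.sum a ≡ m → ∀ i → a i ≡ 1
ℕ∑≡m⇒all-one {suc m} a pos Σa≡m = all-one
  where
  Σrest : ℕ
  Σrest = ℕ∑.sum (λ i → a (suc i))
  a₀≡1 : a zero ≡ 1
  a₀≡1 = ℕP.≤-antisym (ℕP.+-cancelʳ-≤ m (a zero) 1 (ℕP.≤-trans
           (ℕP.+-monoʳ-≤ (a zero) (ℕ∑≥m (λ i → a (suc i)) (λ i → pos (suc i)))) (ℕP.≤-reflexive Σa≡m))) (pos zero)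
  all-one : ∀ i → a i ≡ 1
  all-one zero = a₀≡1
  all-one (suc i) = ℕ∑≡m⇒all-one (λ i → a (suc i)) (λ i → pos (suc i))
    (ℕP.suc-injective (trans (cong (ℕ._+ Σrest) (sym a₀≡1)) Σa≡m)) i

-- Combinations of lattice points with constrained coefficients

Coeffs : List (ZPt N) → Set
Coeffs [] = ⊤
Coeffs (_ ∷ V) = ℚ × Coeffs V

weight : (V : List (ZPt N)) → Coeffs V → ℚ
weight [] _ = 0ℚ
weight (_ ∷ V) (c , cs) = c + weight V cs

combination : (V : List (ZPt N)) → Coeffs V → Pt N
combination [] _ j = 0ℚ
combination (v ∷ V) (c , cs) j = c * ιℤ (v j) + combination V cs j

AllCoeffs : (ℚ → Set) → (V : List (ZPt N)) → Coeffs V → Set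
AllCoeffs R [] _ = ⊤
AllCoeffs R (_ ∷ V) (c , cs) = R c × AllCoeffs R V cs

-- For R = (0ℚ ≤_) and V ≠ [] this is t · conv V; for R = (0ℚ <_) and t > 0 it is the
-- relative interior of t · conv V.
record Comb (R : ℚ → Set) (V : List (ZPt N)) (t : ℚ) (x : Pt N) : Set where
  constructor comb
  field
    coeffs : Coeffs V
    coeffs-∈ : AllCoeffs R V coeffs
    weight≡ : weight V coeffs ≡ t
    point≗ : x ≗ combination V coeffs

linCoeffs : (V : List (ZPt N)) → ℚ → ℚ → Coeffs V → Coeffs V → Coeffs V
linCoeffs [] α β _ _ = tt
linCoeffs (_ ∷ V) α β (c , cs) (d , ds) = α * c + β * d , linCoeffs V α β cs ds

weight-lin : ∀ (V : List (ZPt N)) α β cs ds → weight V (linCoeffs V α β cs ds) ≡ α * weight V cs + β * weight V ds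
weight-lin [] α β _ _ = solve 2 (λ α β → con 0ℚ := α :* con 0ℚ :+ β :* con 0ℚ) refl α β
weight-lin (_ ∷ V) α β (c , cs) (d , ds) rewrite weight-lin V α β cs ds =
  solve 6 (λ α β c d s t → (α :* c :+ β :* d) :+ (α :* s :+ β :* t) := α :* (c :+ s) :+ β :* (d :+ t))
    refl α β c d (weight V cs) (weight V ds)

combination-lin : ∀ (V : List (ZPt N)) α β cs ds j →
  combination V (linCoeffs V α β cs ds) j ≡ α * combination V cs j + β * combination V ds j
combination-lin [] α β _ _ j = solve 2 (λ α β → con 0ℚ := α :* con 0ℚ :+ β :* con 0ℚ) refl α β
combination-lin (v ∷ V) α β (c , cs) (d , ds) j rewrite combination-lin V α β cs ds j =
  solve 7 (λ α β c d w s t → (α :* c :+ β :* d) :* w :+ (α :* s :+ β :* t) := α :* (c :* w :+ s) :+ β :* (d :* w :+ t))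
    refl α β c d (ιℤ (v j)) (combination V cs j) (combination V ds j)

AllCoeffs-lin : ∀ {R₁ R₂ R₃ : ℚ → Set} (V : List (ZPt N)) α β {cs ds} →
  (∀ {c d} → R₁ c → R₂ d → R₃ (α * c + β * d)) →
  AllCoeffs R₁ V cs → AllCoeffs R₂ V ds → AllCoeffs R₃ V (linCoeffs V α β cs ds)
AllCoeffs-lin [] α β f _ _ = tt
AllCoeffs-lin (_ ∷ V) α β f (p , ps) (q , qs) = f p q , AllCoeffs-lin V α β f ps qs

AllCoeffs-map : ∀ {R R' : ℚ → Set} (V : List (ZPt N)) {cs} → (∀ {c} → R c → R' c) →
  AllCoeffs R V cs → AllCoeffs R' V cs
AllCoeffs-map [] f _ = tt
AllCoeffs-map (_ ∷ V) f (p , ps) = f p , AllCoeffs-map V f ps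

weight-nonNeg : ∀ (V : List (ZPt N)) {cs} → AllCoeffs (0ℚ ≤_) V cs → 0ℚ ≤ weight V cs
weight-nonNeg [] _ = ≤-refl
weight-nonNeg (_ ∷ V) (p , ps) = +-mono-≤ p (weight-nonNeg V ps)

coeff≤weight : ∀ (V : List (ZPt N)) {cs} → AllCoeffs (0ℚ ≤_) V cs →
  AllCoeffs (λ c → 0ℚ ≤ c × c ≤ weight V cs) V cs
coeff≤weight [] _ = tt
coeff≤weight (_ ∷ V) {c , cs} (p , ps) =
  (p , p≤p+q (weight-nonNeg V ps)) ,
  AllCoeffs-map V (λ (q , d≤w) → q , ≤-trans d≤w (subst (weight V cs ≤_) (+-comm _ c) (p≤p+q p)))
    (coeff≤weight V ps)

minCoeff : (V : List (ZPt N)) → Coeffs V → ℚ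
minCoeff [] _ = 1ℚ
minCoeff (_ ∷ V) (c , cs) = c ⊓ minCoeff V cs

minCoeff-pos : ∀ (V : List (ZPt N)) {cs} → AllCoeffs (0ℚ <_) V cs → 0ℚ < minCoeff V cs
minCoeff-pos [] _ = 0<1
minCoeff-pos (_ ∷ V) (p , ps) = pos-⊓ p (minCoeff-pos V ps)

minCoeff≤ : ∀ (V : List (ZPt N)) cs → AllCoeffs (minCoeff V cs ≤_) V cs
minCoeff≤ [] _ = tt
minCoeff≤ (_ ∷ V) (c , cs) =
  p⊓q≤p c (minCoeff V cs) , AllCoeffs-map V (≤-trans (p⊓q≤q c (minCoeff V cs))) (minCoeff≤ V cs)

module _ {V : List (ZPt N)} where

  Comb-lin : ∀ {R₁ R₂ R₃ : ℚ → Set} {s u x y} α β → (∀ {c d} → R₁ c → R₂ d → R₃ (α * c + β * d)) →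
    Comb R₁ V s x → Comb R₂ V u y → Comb R₃ V (α * s + β * u) (λ j → α * x j + β * y j)
  Comb-lin α β f (comb cs ps refl x≗) (comb ds qs refl y≗) =
    comb (linCoeffs V α β cs ds) (AllCoeffs-lin V α β f ps qs) (weight-lin V α β cs ds)
      λ j → trans (cong₂ (λ a b → α * a + β * b) (x≗ j) (y≗ j)) (sym (combination-lin V α β cs ds j))

  Comb-≗ : ∀ {R t x x'} → Comb R V t x → x' ≗ x → Comb R V t x'
  Comb-≗ (comb cs ps w x≗) x'≗x = comb cs ps w λ j → trans (x'≗x j) (x≗ j)

  Comb-≡ : ∀ {R t t' x} → Comb R V t x → t ≡ t' → Comb R V t' x
  Comb-≡ (comb cs ps w x≗) t≡t' = comb cs ps (trans w t≡t') x≗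

  Comb-mono : ∀ {R R' : ℚ → Set} {t} → (∀ {c} → R c → R' c) → Comb R V t ⊆ Comb R' V t
  Comb-mono f (comb cs ps w x≗) = comb cs (AllCoeffs-map V f ps) w x≗

  Comb-weight-nonNeg : ∀ {t x} → Comb (0ℚ ≤_) V t x → 0ℚ ≤ t
  Comb-weight-nonNeg (comb cs ps refl _) = weight-nonNeg V ps

  Comb-zero : Comb (0ℚ ≤_) V 0ℚ ⊆ zeroSet
  Comb-zero (comb cs ps w≡0 x≗) j = trans (x≗ j) (combination-zero V ps w≡0 j)
    where
    combination-zero : ∀ (V : List (ZPt N)) {cs} → AllCoeffs (0ℚ ≤_) V cs → weight V cs ≡ 0ℚ →
      combination V cs ≗ (λ _ → 0ℚ)
    combination-zero [] _ _ j = refl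
    combination-zero (v ∷ V) {c , cs} (p , ps) w≡0 j with nonNeg-+≡0 p (weight-nonNeg V ps) w≡0
    ... | refl , w'≡0 rewrite combination-zero V ps w'≡0 j =
      solve 1 (λ x → con 0ℚ :* x :+ con 0ℚ := con 0ℚ) refl (ιℤ (v j))

  Comb-* : ∀ {R R' : ℚ → Set} {t x} k → (∀ {c} → R c → R' (k * c)) →
    Comb R V t x → Comb R' V (k * t) (λ j → k * x j)
  Comb-* {R' = R'} {t} {x} k f h =
    Comb-≗ (Comb-≡ (Comb-lin k 0ℚ (λ {c} {d} p _ → subst R' (sym (drop c d)) (f p)) h h) (drop t t))
      λ j → sym (drop (x j) (x j))
    where
    drop : ∀ c d → k * c + 0ℚ * d ≡ k * c
    drop c d = solve 3 (λ k c d → k :* c :+ con 0ℚ :* d := k :* c) refl k c d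

  Comb-+ : ∀ {R₁ R₂ R₃ : ℚ → Set} {s u x y} → (∀ {c d} → R₁ c → R₂ d → R₃ (c + d)) →
    Comb R₁ V s x → Comb R₂ V u y → Comb R₃ V (s + u) (λ j → x j + y j)
  Comb-+ {R₃ = R₃} {s} {u} {x} {y} f hx hy =
    Comb-≗ (Comb-≡ (Comb-lin 1ℚ 1ℚ (λ {c} {d} p q → subst R₃ (sym (ones c d)) (f p q)) hx hy) (ones s u))
      λ j → sym (ones (x j) (y j))
    where
    ones : ∀ a b → 1ℚ * a + 1ℚ * b ≡ a + b
    ones a b = cong₂ _+_ (*-identityˡ a) (*-identityˡ b)

Comb-origin : (V : List (ZPt N)) → Comb (0ℚ ≤_) V 0ℚ (λ _ → 0ℚ)
Comb-origin [] = comb tt tt refl λ _ → refl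
Comb-origin (v ∷ V) with Comb-origin V
... | comb cs ps w≡0 0≗ = comb (0ℚ , cs) (≤-refl , ps) (trans (cong (0ℚ +_) w≡0) (+-identityˡ 0ℚ))
  λ j → sym (trans (cong (0ℚ * ιℤ (v j) +_) (sym (0≗ j))) (solve 1 (λ x → con 0ℚ :* x :+ con 0ℚ := con 0ℚ) refl (ιℤ (v j))))

Comb-nonempty : ∀ (v : ZPt N) V {t} → 0ℚ ≤ t → ∃ (Comb (0ℚ ≤_) (v ∷ V) t)
Comb-nonempty v V {t} 0≤t with Comb-origin V
... | comb cs ps w≡0 _ = _ , comb (t , cs) (0≤t , ps) (trans (cong (t +_) w≡0) (+-identityʳ t)) λ _ → refl

Comb-weight-pos : ∀ {v : ZPt N} {V t x} → Comb (0ℚ <_) (v ∷ V) t x → 0ℚ < t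
Comb-weight-pos {V = V} (comb (c , cs) (p , ps) refl _) = +-mono-<-≤ p (weight-nonNeg V (AllCoeffs-map V <⇒≤ ps))

Comb-pos-nonempty : ∀ (v : ZPt N) V {t} → 0ℚ < t → ∃ (Comb (0ℚ <_) (v ∷ V) t)
Comb-pos-nonempty v V {t} 0<t =
  let q , 0<q , wq≡1 = pos-inverse (Comb-weight-pos barycentre)
  in _ , Comb-≡ (Comb-* (t * q) (pos-* (pos-* 0<t 0<q)) barycentre)
           (trans (solve 3 (λ t q w → t :* q :* w := t :* (w :* q)) refl t q w) (trans (cong (t *_) wq≡1) (*-identityʳ t)))
  where
  ones : (V : List (ZPt N)) → Σ (Coeffs V) (AllCoeffs (0ℚ <_) V)
  ones [] = tt , tt
  ones (_ ∷ V) = let cs , ps = ones V in (1ℚ , cs) , (0<1 , ps)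
  w : ℚ
  w = weight (v ∷ V) (proj₁ (ones (v ∷ V)))
  barycentre : Comb (0ℚ <_) (v ∷ V) w (combination (v ∷ V) (proj₁ (ones (v ∷ V))))
  barycentre = comb (proj₁ (ones (v ∷ V))) (proj₂ (ones (v ∷ V))) refl λ _ → refl

listCombination : List ℚ → List (ZPt N) → Pt N
listCombination cs V j = sumℚ (zipWith (λ c v → c * ιℤ (v j)) cs V)

conv⇒Comb : ∀ {V : List (ZPt N)} → conv V ⊆ Comb (0ℚ ≤_) V 1ℚ
conv⇒Comb {V = V} (cs , len , ps , Σcs≡1 , x≗) = coeffs-from-list V cs len ps Σcs≡1 x≗
  where
  coeffs-from-list : ∀ (V : List (ZPt N)) cs {t x} → length cs ≡ length V → All (0ℚ ≤_) cs → sumℚ cs ≡ t →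
    x ≗ listCombination cs V → Comb (0ℚ ≤_) V t x
  coeffs-from-list [] [] _ [] Σcs≡t x≗ = comb tt tt Σcs≡t x≗
  coeffs-from-list (v ∷ V) (c ∷ cs) len (p ∷ ps) Σcs≡t x≗ with coeffs-from-list V cs (ℕP.suc-injective len) ps refl (λ _ → refl)
  ... | comb ds qs w x'≗ =
    comb (c , ds) (p , qs) (trans (cong (c +_) w) Σcs≡t) λ j → trans (x≗ j) (cong (c * ιℤ (v j) +_) (x'≗ j))

Comb⇒conv : ∀ {V : List (ZPt N)} → Comb (0ℚ ≤_) V 1ℚ ⊆ conv V
Comb⇒conv {V = V} = coeffs-to-list V
  where
  coeffs-to-list : ∀ (V : List (ZPt N)) {t x} → Comb (0ℚ ≤_) V t x → Σ (List ℚ) λ cs →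
    length cs ≡ length V × All (0ℚ ≤_) cs × sumℚ cs ≡ t × x ≗ listCombination cs V
  coeffs-to-list [] (comb _ _ w x≗) = [] , refl , [] , w , x≗
  coeffs-to-list (v ∷ V) (comb (d , ds) (p , ps) w x≗) with coeffs-to-list V (comb ds ps refl (λ _ → refl))
  ... | cs , len , qs , Σcs≡w , ≗ =
    d ∷ cs , cong suc len , p ∷ qs , trans (cong (d +_) Σcs≡w) w , λ j → trans (x≗ j) (cong (d * ιℤ (v j) +_) (≗ j))

scale-mono : ∀ {S T : RSet N} n → S ⊆ T → scale n S ⊆ scale n T
scale-mono n S⊆T (x , x∈S , y≗) = x , S⊆T x∈S , y≗

scale-zero : ∀ {S : RSet N} → scale 0 S ⊆ zeroSet
scale-zero (x , _ , y≗) j = trans (y≗ j) (*-zeroˡ (x j))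

scale-scale⇒ : ∀ {S : RSet N} n k → scale n (scale k S) ⊆ scale (n ℕ.* k) S
scale-scale⇒ n k {z} (y , (x , x∈S , y≗) , z≗) = x , x∈S , λ j → begin
  z j                      ≡⟨ z≗ j ⟩
  ιℕ n * y j               ≡⟨ cong (ιℕ n *_) (y≗ j) ⟩
  ιℕ n * (ιℕ k * x j)      ≡⟨ *-assoc (ιℕ n) (ιℕ k) (x j) ⟨
  ιℕ n * ιℕ k * x j        ≡⟨ cong (_* x j) (ιℕ-* n k) ⟨
  ιℕ (n ℕ.* k) * x j       ∎
  where open ≡-Reasoning

scale-scale⇐ : ∀ {S : RSet N} n k → scale (n ℕ.* k) S ⊆ scale n (scale k S)
scale-scale⇐ n k (x , x∈S , z≗) = (λ j → ιℕ k * x j) , (x , x∈S , λ _ → refl) ,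
  λ j → trans (z≗ j) (trans (cong (_* x j) (ιℕ-* n k)) (*-assoc (ιℕ n) (ιℕ k) (x j)))

⊕-mono : ∀ {A A' B B' : RSet N} → A ⊆ A' → B ⊆ B' → A ⊕ B ⊆ A' ⊕ B'
⊕-mono A⊆A' B⊆B' (a , b , a∈A , b∈B , x≗) = a , b , A⊆A' a∈A , B⊆B' b∈B , x≗

ΣR-mono : ∀ {Q Q' : Fin m → RSet N} → (∀ i → Q i ⊆ Q' i) → ΣR Q ⊆ ΣR Q'
ΣR-mono {m = zero} Q⊆Q' x∈0 = x∈0
ΣR-mono {m = suc m} {Q = Q} {Q'} Q⊆Q' =
  ⊕-mono (Q⊆Q' zero) (ΣR-mono {Q = λ i → Q (suc i)} {λ i → Q' (suc i)} (λ i → Q⊆Q' (suc i)))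

scale-ΣR⇒ : ∀ {Q : Fin m → RSet N} n → scale n (ΣR Q) ⊆ ΣR (λ i → scale n (Q i))
scale-ΣR⇒ {m = zero} n (x , x≗0 , y≗) j = trans (y≗ j) (trans (cong (ιℕ n *_) (x≗0 j)) (*-zeroʳ (ιℕ n)))
scale-ΣR⇒ {m = suc m} {Q = Q} n (x , (a , b , a∈ , b∈ , x≗) , y≗) =
  (λ j → ιℕ n * a j) , (λ j → ιℕ n * b j) , (a , a∈ , λ _ → refl) , scale-ΣR⇒ {Q = λ i → Q (suc i)} n (b , b∈ , λ _ → refl) ,
  λ j → trans (y≗ j) (trans (cong (ιℕ n *_) (x≗ j)) (*-distribˡ-+ (ιℕ n) (a j) (b j)))

scale-ΣR⇐ : ∀ {Q : Fin m → RSet N} n → ΣR (λ i → scale n (Q i)) ⊆ scale n (ΣR Q)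
scale-ΣR⇐ {m = zero} n y≗0 = (λ _ → 0ℚ) , (λ _ → refl) , λ j → trans (y≗0 j) (sym (*-zeroʳ (ιℕ n)))
scale-ΣR⇐ {m = suc m} {Q = Q} n (a , b , (x , x∈ , a≗) , b∈ , y≗) with scale-ΣR⇐ {Q = λ i → Q (suc i)} n b∈
... | x' , x'∈ , b≗ = (λ j → x j + x' j) , (x , x' , x∈ , x'∈ , λ _ → refl) ,
  λ j → trans (y≗ j) (trans (cong₂ _+_ (a≗ j) (b≗ j)) (sym (*-distribˡ-+ (ιℕ n) (x j) (x' j))))

scale-ΣR-scale⇒ : ∀ {Q : Fin m → RSet N} (a : Fin m → ℕ) k →
  scale k (ΣR (λ i → scale (a i) (Q i))) ⊆ ΣR (λ i → scale (k ℕ.* a i) (Q i))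
scale-ΣR-scale⇒ {Q = Q} a k x∈ =
  ΣR-mono {Q' = λ i → scale (k ℕ.* a i) (Q i)} (λ i → scale-scale⇒ k (a i)) (scale-ΣR⇒ {Q = λ i → scale (a i) (Q i)} k x∈)

scale-ΣR-scale⇐ : ∀ {Q : Fin m → RSet N} (a : Fin m → ℕ) k →
  ΣR (λ i → scale (k ℕ.* a i) (Q i)) ⊆ scale k (ΣR (λ i → scale (a i) (Q i)))
scale-ΣR-scale⇐ {Q = Q} a k x∈ = scale-ΣR⇐ {Q = λ i → scale (a i) (Q i)} k
  (ΣR-mono {Q = λ i → scale (k ℕ.* a i) (Q i)} {λ i → scale k (scale (a i) (Q i))} (λ i → scale-scale⇐ k (a i)) x∈)

scale-Comb⇒ : ∀ {V : List (ZPt N)} {t} n → scale n (Comb (0ℚ ≤_) V t) ⊆ Comb (0ℚ ≤_) V (ιℕ n * t)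
scale-Comb⇒ n (x , x∈ , y≗) = Comb-≗ (Comb-* (ιℕ n) (nonNeg-* (ιℕ-nonNeg n)) x∈) y≗

scale-Comb⇐ : ∀ {v : ZPt N} {V t} n → 0ℚ ≤ t → Comb (0ℚ ≤_) (v ∷ V) (ιℕ n * t) ⊆ scale n (Comb (0ℚ ≤_) (v ∷ V) t)
scale-Comb⇐ {v = v} {V} {t} zero 0≤t y∈ with Comb-nonempty v V 0≤t
... | x , x∈ = x , x∈ , λ j → trans (Comb-zero (Comb-≡ y∈ (*-zeroˡ t)) j) (sym (*-zeroˡ (x j)))
scale-Comb⇐ {t = t} (suc n) 0≤t {y} y∈ = (λ j → q * y j) ,
  Comb-≡ (Comb-* q (nonNeg-* (<⇒≤ 0<q)) y∈) (cancel t) , λ j → sym (cancel′ (y j))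
  where
  inverse : ∃[ q ] 0ℚ < q × ιℕ (suc n) * q ≡ 1ℚ
  inverse = pos-inverse (ιℕ-pos n)
  q : ℚ
  q = proj₁ inverse
  0<q : 0ℚ < q
  0<q = proj₁ (proj₂ inverse)
  cancel : ∀ a → q * (ιℕ (suc n) * a) ≡ a
  cancel a = trans (solve 3 (λ q k a → q :* (k :* a) := k :* q :* a) refl q (ιℕ (suc n)) a)
               (trans (cong (_* a) (proj₂ (proj₂ inverse))) (*-identityˡ a))
  cancel′ : ∀ a → ιℕ (suc n) * (q * a) ≡ a
  cancel′ a = trans (solve 3 (λ q k a → k :* (q :* a) := k :* q :* a) refl q (ιℕ (suc n)) a)
               (trans (cong (_* a) (proj₂ (proj₂ inverse))) (*-identityˡ a))

scale-conv⇒ : ∀ {V : List (ZPt N)} n → scale n (conv V) ⊆ Comb (0ℚ ≤_) V (ιℕ n)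
scale-conv⇒ n y∈ = Comb-≡ (scale-Comb⇒ n (scale-mono n conv⇒Comb y∈)) (*-identityʳ (ιℕ n))

scale-conv⇐ : ∀ {v : ZPt N} {V} n → Comb (0ℚ ≤_) (v ∷ V) (ιℕ n) ⊆ scale n (conv (v ∷ V))
scale-conv⇐ n y∈ = scale-mono n Comb⇒conv (scale-Comb⇐ n (<⇒≤ 0<1) (Comb-≡ y∈ (sym (*-identityʳ (ιℕ n)))))

sumPt : (Fin m → Pt N) → Pt N
sumPt xs j = ℚ∑.sum (λ i → xs i j)

ΣRᶠ : (Fin m → RSet N) → RSet N
ΣRᶠ Q x = ∃[ xs ] (∀ i → Q i (xs i)) × x ≗ sumPt xs

ΣR⊆ΣRᶠ : ∀ {Q : Fin m → RSet N} → ΣR Q ⊆ ΣRᶠ Q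
ΣR⊆ΣRᶠ {m = zero} x≗0 = (λ ()) , (λ ()) , x≗0
ΣR⊆ΣRᶠ {m = suc m} {Q = Q} (y , z , y∈ , z∈ , x≗) with ΣR⊆ΣRᶠ {Q = λ i → Q (suc i)} z∈
... | zs , zs∈ , z≗ = (λ { zero → y ; (suc i) → zs i }) , (λ { zero → y∈ ; (suc i) → zs∈ i }) ,
  λ j → trans (x≗ j) (cong (y j +_) (z≗ j))

ΣRᶠ⊆ΣR : ∀ {Q : Fin m → RSet N} → ΣRᶠ Q ⊆ ΣR Q
ΣRᶠ⊆ΣR {m = zero} (_ , _ , x≗) = x≗
ΣRᶠ⊆ΣR {m = suc m} {Q = Q} (xs , xs∈ , x≗) =
  xs zero , sumPt (λ i → xs (suc i)) , xs∈ zero , ΣRᶠ⊆ΣR {Q = λ i → Q (suc i)} ((λ i → xs (suc i)) , (λ i → xs∈ (suc i)) , λ _ → refl) , x≗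

ΣRᶠ-mono : ∀ {Q Q' : Fin m → RSet N} → (∀ i → Q i ⊆ Q' i) → ΣRᶠ Q ⊆ ΣRᶠ Q'
ΣRᶠ-mono Q⊆Q' (xs , xs∈ , x≗) = xs , (λ i → Q⊆Q' i (xs∈ i)) , x≗

ΣRᶠ-Comb-+ : ∀ {R₁ R₂ R₃ : ℚ → Set} (Vs : Fin m → List (ZPt N)) (ss us : Fin m → ℚ) {x y} → (∀ {c d} → R₁ c → R₂ d → R₃ (c + d)) →
  ΣRᶠ (λ i → Comb R₁ (Vs i) (ss i)) x → ΣRᶠ (λ i → Comb R₂ (Vs i) (us i)) y →
  ΣRᶠ (λ i → Comb R₃ (Vs i) (ss i + us i)) (λ j → x j + y j)
ΣRᶠ-Comb-+ Vs ss us R-+ (xs , xs∈ , x≗) (ys , ys∈ , y≗) =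
  (λ i j → xs i j + ys i j) , (λ i → Comb-+ R-+ (xs∈ i) (ys∈ i)) ,
  λ j → trans (cong₂ _+_ (x≗ j) (y≗ j)) (sym (ℚ∑.∑-distrib-+ (λ i → xs i j) (λ i → ys i j)))

ℚ∑-lin : ∀ {m} (f g : Fin m → ℚ) α β → ℚ∑.sum (λ i → α * f i + β * g i) ≡ α * ℚ∑.sum f + β * ℚ∑.sum g
ℚ∑-lin f g α β = trans (ℚ∑.∑-distrib-+ (λ i → α * f i) (λ i → β * g i))
  (sym (cong₂ _+_ (ℚ∑.*-distribˡ-sum α f) (ℚ∑.*-distribˡ-sum β g)))

-- Relative interiors

relint-cong : ∀ {S T : RSet N} → S ⊆ T → T ⊆ S → relint S ⊆ relint T
relint-cong S⊆T T⊆S (x∈S , extend) = S⊆T x∈S , λ y y∈T →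
  let ε , 0<ε , z∈S = extend y (T⊆S y∈T) in ε , 0<ε , S⊆T z∈S

-- With μ the least coefficient of x, the coefficients of x + δ (x - y) are at least
-- μ - δ t ≥ 0 as long as δ ≤ μ / (1 + t).
Comb-extend : ∀ {V : List (ZPt N)} {t x y} → Comb (0ℚ <_) V t x → Comb (0ℚ ≤_) V t y →
  ∃[ ε ] 0ℚ < ε × (∀ {δ} → 0ℚ ≤ δ → δ ≤ ε → Comb (0ℚ ≤_) V t (λ j → x j + δ * (x j - y j)))
Comb-extend {V = V} {t} {x} {y} x∈@(comb cs ps w x≗) y∈@(comb ds qs w' y≗) =
  μ * q , pos-* (minCoeff-pos V ps) 0<q ,
  λ {δ} 0≤δ δ≤ε → Comb-≗ (Comb-≡ (Comb-lin (1ℚ + δ) (- δ) (coeff-nonNeg 0≤δ δ≤ε) x∈μ y∈[0,t])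
    (solve 2 (λ δ t → (con 1ℚ :+ δ) :* t :+ (:- δ) :* t := t) refl δ t))
    λ j → solve 3 (λ δ x y → x :+ δ :* (x :- y) := (con 1ℚ :+ δ) :* x :+ (:- δ) :* y) refl δ (x j) (y j)
  where
  μ : ℚ
  μ = minCoeff V cs
  0≤t : 0ℚ ≤ t
  0≤t = Comb-weight-nonNeg y∈
  inverse : ∃[ q ] 0ℚ < q × (1ℚ + t) * q ≡ 1ℚ
  inverse = pos-inverse (+-mono-<-≤ 0<1 0≤t)
  q : ℚ
  q = proj₁ inverse
  0<q : 0ℚ < q
  0<q = proj₁ (proj₂ inverse)
  x∈μ : Comb (μ ≤_) V t x
  x∈μ = comb cs (minCoeff≤ V cs) w x≗
  y∈[0,t] : Comb (λ d → 0ℚ ≤ d × d ≤ t) V t y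
  y∈[0,t] = comb ds (subst (λ s → AllCoeffs (λ d → 0ℚ ≤ d × d ≤ s) V ds) w' (coeff≤weight V qs)) w' y≗
  εt+ε≡μ : μ * q * t + μ * q ≡ μ
  εt+ε≡μ = trans (solve 3 (λ μ q t → μ :* q :* t :+ μ :* q := μ :* ((con 1ℚ :+ t) :* q)) refl μ q t)
             (trans (cong (μ *_) (proj₂ (proj₂ inverse))) (*-identityʳ μ))
  coeff-nonNeg : ∀ {δ} → 0ℚ ≤ δ → δ ≤ μ * q → ∀ {c d} → μ ≤ c → 0ℚ ≤ d × d ≤ t →
    0ℚ ≤ (1ℚ + δ) * c + (- δ) * d
  coeff-nonNeg {δ} 0≤δ δ≤ε {c} {d} μ≤c (0≤d , d≤t) =
    subst (0ℚ ≤_) (solve 3 (λ δ c d → (c :- δ :* d) :+ δ :* c := (con 1ℚ :+ δ) :* c :+ (:- δ) :* d) refl δ c d)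
      (+-mono-≤ (p≤q⇒0≤q-p δd≤c) (nonNeg-* 0≤δ 0≤c))
    where
    0≤ε : 0ℚ ≤ μ * q
    0≤ε = ≤-trans 0≤δ δ≤ε
    δd≤c : δ * d ≤ c
    δd≤c = ≤-trans (*-monoʳ-≤-nonNeg d {{nonNegative 0≤d}} δ≤ε)
             (≤-trans (*-monoˡ-≤-nonNeg (μ * q) {{nonNegative 0≤ε}} d≤t)
               (≤-trans (p≤p+q 0≤ε) (≤-trans (≤-reflexive εt+ε≡μ) μ≤c)))
    0≤c : 0ℚ ≤ c
    0≤c = ≤-trans (<⇒≤ (minCoeff-pos V ps)) μ≤c

Comb-mix : ∀ {V : List (ZPt N)} {t s y} α ε → 0ℚ < α → 0ℚ < ε → (1ℚ + ε) * α ≡ 1ℚ →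
  Comb (0ℚ ≤_) V t s → Comb (0ℚ <_) V t y → Comb (0ℚ <_) V t (λ j → α * s j + ε * α * y j)
Comb-mix {t = t} α ε 0<α 0<ε α≡1/[1+ε] s∈ y∈ =
  Comb-≡ (Comb-lin α (ε * α) coeff-pos s∈ y∈)
    (trans (solve 3 (λ α ε t → α :* t :+ ε :* α :* t := ((con 1ℚ :+ ε) :* α) :* t) refl α ε t)
      (trans (cong (_* t) α≡1/[1+ε]) (*-identityˡ t)))
  where
  coeff-pos : ∀ {c d} → 0ℚ ≤ c → 0ℚ < d → 0ℚ < α * c + ε * α * d
  coeff-pos {c} {d} 0≤c 0<d =
    subst (0ℚ <_) (+-comm (ε * α * d) (α * c)) (+-mono-<-≤ (pos-* (pos-* 0<ε 0<α) 0<d) (nonNeg-* (<⇒≤ 0<α) 0≤c))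

mix-extension : ∀ α ε x y → (1ℚ + ε) * α ≡ 1ℚ → α * (x + ε * (x - y)) + ε * α * y ≡ x
mix-extension α ε x y α≡1/[1+ε] =
  trans (solve 4 (λ α ε x y → α :* (x :+ ε :* (x :- y)) :+ ε :* α :* y := ((con 1ℚ :+ ε) :* α) :* x) refl α ε x y)
    (trans (cong (_* x) α≡1/[1+ε]) (*-identityˡ x))

Comb-pos⇒relint : ∀ {V : List (ZPt N)} {t} → Comb (0ℚ <_) V t ⊆ relint (Comb (0ℚ ≤_) V t)
Comb-pos⇒relint x∈ = Comb-mono <⇒≤ x∈ , λ y y∈ → let ε , 0<ε , extend = Comb-extend x∈ y∈ in ε , 0<ε , extend (<⇒≤ 0<ε) ≤-refl

-- x is a convex combination of an interior point y and a point x + ε (x - y) of the cone.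
relint⇒Comb-pos : ∀ {v : ZPt N} {V t} → 0ℚ < t → relint (Comb (0ℚ ≤_) (v ∷ V) t) ⊆ Comb (0ℚ <_) (v ∷ V) t
relint⇒Comb-pos {v = v} {V} 0<t {x} (_ , extend) =
  let y , y∈ = Comb-pos-nonempty v V 0<t
      ε , 0<ε , s∈ = extend y (Comb-mono <⇒≤ y∈)
      α , 0<α , α≡1/[1+ε] = pos-inverse (+-mono-<-≤ 0<1 (<⇒≤ 0<ε))
  in Comb-≗ (Comb-mix α ε 0<α 0<ε α≡1/[1+ε] s∈ y∈) λ j → sym (mix-extension α ε (x j) (y j) α≡1/[1+ε])

minimum : (Fin m → ℚ) → ℚ
minimum {m = zero} f = 1ℚ
minimum {m = suc m} f = f zero ⊓ minimum (λ i → f (suc i))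

minimum-pos : ∀ (f : Fin m → ℚ) → (∀ i → 0ℚ < f i) → 0ℚ < minimum f
minimum-pos {m = zero} f _ = 0<1
minimum-pos {m = suc m} f pos = pos-⊓ (pos zero) (minimum-pos (λ i → f (suc i)) (λ i → pos (suc i)))

minimum≤ : ∀ (f : Fin m → ℚ) i → minimum f ≤ f i
minimum≤ {m = suc m} f zero = p⊓q≤p (f zero) _
minimum≤ {m = suc m} f (suc i) = ≤-trans (p⊓q≤q (f zero) _) (minimum≤ (λ i → f (suc i)) i)

module _ (Vs : Fin m → List (ZPt N)) (ts : Fin m → ℚ) where

  ΣRᶠ-pos⇒relint : ΣRᶠ (λ i → Comb (0ℚ <_) (Vs i) (ts i)) ⊆ relint (ΣRᶠ (λ i → Comb (0ℚ ≤_) (Vs i) (ts i)))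
  ΣRᶠ-pos⇒relint (xs , xs∈ , x≗) = (xs , (λ i → Comb-mono <⇒≤ (xs∈ i)) , x≗) , λ y (ys , ys∈ , y≗) →
    let extension i = Comb-extend (xs∈ i) (ys∈ i)
        ε = minimum (λ i → proj₁ (extension i))
        0<ε = minimum-pos _ (λ i → proj₁ (proj₂ (extension i)))
    in ε , 0<ε ,
       (λ i j → xs i j + ε * (xs i j - ys i j)) ,
       (λ i → proj₂ (proj₂ (extension i)) (<⇒≤ 0<ε) (minimum≤ (λ i → proj₁ (extension i)) i)) ,
       λ j → trans (cong₂ (λ a b → a + ε * (a - b)) (x≗ j) (y≗ j)) (sym (sumPt-extension xs ys ε j))
    where
    sumPt-extension : ∀ (as bs : Fin m → Pt N) δ j →
      sumPt (λ i j → as i j + δ * (as i j - bs i j)) j ≡ sumPt as j + δ * (sumPt as j - sumPt bs j)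
    sumPt-extension as bs δ j = begin
      ℚ∑.sum (λ i → as i j + δ * (as i j - bs i j))
        ≡⟨ ℚ∑.sum-cong-≗ (λ i → solve 3 (λ δ a b → a :+ δ :* (a :- b) := (con 1ℚ :+ δ) :* a :+ (:- δ) :* b) refl δ (as i j) (bs i j)) ⟩
      ℚ∑.sum (λ i → (1ℚ + δ) * as i j + (- δ) * bs i j)
        ≡⟨ ℚ∑-lin (λ i → as i j) (λ i → bs i j) (1ℚ + δ) (- δ) ⟩
      (1ℚ + δ) * sumPt as j + (- δ) * sumPt bs j
        ≡⟨ solve 3 (λ δ a b → (con 1ℚ :+ δ) :* a :+ (:- δ) :* b := a :+ δ :* (a :- b)) refl δ (sumPt as j) (sumPt bs j) ⟩
      sumPt as j + δ * (sumPt as j - sumPt bs j) ∎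
      where open ≡-Reasoning

relint⇒ΣRᶠ-pos : ∀ (P : Fin m → Poly N) (ts : Fin m → ℚ) → (∀ i → 0ℚ < ts i) →
  relint (ΣRᶠ (λ i → Comb (0ℚ ≤_) (toList (P i)) (ts i))) ⊆ ΣRᶠ (λ i → Comb (0ℚ <_) (toList (P i)) (ts i))
relint⇒ΣRᶠ-pos {m = m} {N = N} P ts 0<ts {x} (_ , extend) =
  let ε , 0<ε , ss , ss∈ , s≗ = extend y (ys , (λ i → Comb-mono <⇒≤ (ys∈ i)) , λ _ → refl)
      α , 0<α , α≡1/[1+ε] = pos-inverse (+-mono-<-≤ 0<1 (<⇒≤ 0<ε))
  in (λ i j → α * ss i j + ε * α * ys i j) ,
     (λ i → Comb-mix α ε 0<α 0<ε α≡1/[1+ε] (ss∈ i) (ys∈ i)) ,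
     λ j → sym (begin
       sumPt (λ i j → α * ss i j + ε * α * ys i j) j  ≡⟨ ℚ∑-lin (λ i → ss i j) (λ i → ys i j) α (ε * α) ⟩
       α * sumPt ss j + ε * α * y j                  ≡⟨ cong (λ s → α * s + ε * α * y j) (s≗ j) ⟨
       α * (x j + ε * (x j - y j)) + ε * α * y j     ≡⟨ mix-extension α ε (x j) (y j) α≡1/[1+ε] ⟩
       x j                                           ∎)
  where
  open ≡-Reasoning
  interior : ∀ i → ∃ (Comb (0ℚ <_) (toList (P i)) (ts i))
  interior i = Comb-pos-nonempty (List⁺.head (P i)) (List⁺.tail (P i)) (0<ts i)
  ys : Fin m → Pt N
  ys i = proj₁ (interior i)
  ys∈ : ∀ i → Comb (0ℚ <_) (toList (P i)) (ts i) (ys i)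
  ys∈ i = proj₂ (interior i)
  y : Pt N
  y = sumPt ys

sumZPt : (Fin m → ZPt N) → ZPt N
sumZPt zs k = ℤ∑.sum (λ i → zs i k)

ΣZᶠ : (Fin m → ZSet N) → ZSet N
ΣZᶠ A z = ∃[ zs ] (∀ i → A i (zs i)) × z ≗ sumZPt zs

ΣZ⊆ΣZᶠ : ∀ {A : Fin m → ZSet N} → ΣZ A ⊆ ΣZᶠ A
ΣZ⊆ΣZᶠ {m = zero} z≗0 = (λ ()) , (λ ()) , z≗0
ΣZ⊆ΣZᶠ {m = suc m} {A = A} (y , w , y∈ , w∈ , z≗) with ΣZ⊆ΣZᶠ {A = λ i → A (suc i)} w∈
... | ws , ws∈ , w≗ = (λ { zero → y ; (suc i) → ws i }) , (λ { zero → y∈ ; (suc i) → ws∈ i }) ,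
  λ k → trans (z≗ k) (cong (λ s → y k ℤ.+ s) (w≗ k))

ΣZᶠ⊆ΣZ : ∀ {A : Fin m → ZSet N} → ΣZᶠ A ⊆ ΣZ A
ΣZᶠ⊆ΣZ {m = zero} (_ , _ , z≗) = z≗
ΣZᶠ⊆ΣZ {m = suc m} {A = A} (zs , zs∈ , z≗) =
  zs zero , sumZPt (λ i → zs (suc i)) , zs∈ zero , ΣZᶠ⊆ΣZ {A = λ i → A (suc i)} ((λ i → zs (suc i)) , (λ i → zs∈ (suc i)) , λ _ → refl) , z≗

⊕ℤ-mono : ∀ {A A' B B' : ZSet N} → A ⊆ A' → B ⊆ B' → A ⊕ℤ B ⊆ A' ⊕ℤ B'
⊕ℤ-mono A⊆A' B⊆B' (a , b , a∈A , b∈B , z≗) = a , b , A⊆A' a∈A , B⊆B' b∈B , z≗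

ΣZ-mono : ∀ {A B : Fin m → ZSet N} → (∀ i → A i ⊆ B i) → ΣZ A ⊆ ΣZ B
ΣZ-mono {m = zero} A⊆B z≗0 = z≗0
ΣZ-mono {m = suc m} {A = A} {B} A⊆B =
  ⊕ℤ-mono (A⊆B zero) (ΣZ-mono {A = λ i → A (suc i)} {λ i → B (suc i)} (λ i → A⊆B (suc i)))

LP-⊕ℤ : ∀ {A B : RSet N} → (LP A ⊕ℤ LP B) ⊆ LP (A ⊕ B)
LP-⊕ℤ (a , b , a∈ , b∈ , z≗) = ι a , ι b , a∈ , b∈ , λ k → trans (cong ιℤ (z≗ k)) (ιℤ-+ (a k) (b k))

ΣZ⊆LPΣR : ∀ {Q : Fin m → RSet N} → ΣZ (λ i → LP (Q i)) ⊆ LP (ΣR Q)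
ΣZ⊆LPΣR {m = zero} z≗0 k = cong ιℤ (z≗0 k)
ΣZ⊆LPΣR {m = suc m} {Q = Q} z∈ = LP-⊕ℤ (⊕ℤ-mono (λ a∈ → a∈) (ΣZ⊆LPΣR {Q = λ i → Q (suc i)}) z∈)

ΣZ-⊕ℤ : ∀ {A B : Fin m → ZSet N} → ΣZ (λ i → A i ⊕ℤ B i) ⊆ ΣZ A ⊕ℤ ΣZ B
ΣZ-⊕ℤ {m = zero} z≗0 = (λ _ → ℤ.+ 0) , (λ _ → ℤ.+ 0) , (λ _ → refl) , (λ _ → refl) , z≗0
ΣZ-⊕ℤ {m = suc m} {A = A} {B} (y , w , (a , b , a∈ , b∈ , y≗) , w∈ , z≗) with ΣZ-⊕ℤ {A = λ i → A (suc i)} {λ i → B (suc i)} w∈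
... | a' , b' , a'∈ , b'∈ , w≗ =
  (λ k → a k ℤ.+ a' k) , (λ k → b k ℤ.+ b' k) , (a , a' , a∈ , a'∈ , λ _ → refl) , (b , b' , b∈ , b'∈ , λ _ → refl) ,
  λ k → trans (z≗ k) (trans (cong₂ ℤ._+_ (y≗ k) (w≗ k)) (interchange (a k) (b k) (a' k) (b' k)))
  where open import Algebra.Properties.CommutativeSemigroup ℤP.+-commutativeSemigroup using (interchange)

ΣR-⊕ : ∀ {A B : Fin m → RSet N} → ΣR A ⊕ ΣR B ⊆ ΣR (λ i → A i ⊕ B i)
ΣR-⊕ {m = zero} (y , w , y≗0 , w≗0 , x≗) j = trans (x≗ j) (trans (cong₂ _+_ (y≗0 j) (w≗0 j)) (+-identityˡ 0ℚ))
ΣR-⊕ {m = suc m} {A = A} {B} (y , w , (a , a' , a∈ , a'∈ , y≗) , (b , b' , b∈ , b'∈ , w≗) , x≗) =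
  (λ j → a j + b j) , (λ j → a' j + b' j) , (a , b , a∈ , b∈ , λ _ → refl) ,
  ΣR-⊕ {A = λ i → A (suc i)} {λ i → B (suc i)} (a' , b' , a'∈ , b'∈ , λ _ → refl) ,
  λ j → trans (x≗ j) (trans (cong₂ _+_ (y≗ j) (w≗ j)) (interchange (a j) (a' j) (b j) (b' j)))
  where open import Algebra.Properties.CommutativeSemigroup (CommutativeMonoid.commutativeSemigroup +-0-commutativeMonoid) using (interchange)

nfold : ℕ → ZSet N → ZSet N
nfold zero A = zeroZSet
nfold (suc n) A = nfold n A ⊕ℤ A

nfold-+⇒ : ∀ {A : ZSet N} l k → nfold (l ℕ.+ k) A ⊆ nfold k A ⊕ℤ nfold l A
nfold-+⇒ zero k {z} z∈ = z , (λ _ → ℤ.+ 0) , z∈ , (λ _ → refl) , λ j → sym (ℤP.+-identityʳ (z j))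
nfold-+⇒ (suc l) k (u , w , u∈ , w∈ , z≗) with nfold-+⇒ l k u∈
... | u₁ , u₂ , u₁∈ , u₂∈ , u≗ =
  u₁ , (λ j → u₂ j ℤ.+ w j) , u₁∈ , (u₂ , w , u₂∈ , w∈ , λ _ → refl) ,
  λ j → trans (z≗ j) (trans (cong (λ s → s ℤ.+ w j) (u≗ j)) (ℤP.+-assoc (u₁ j) (u₂ j) (w j)))

nfold-≗ : ∀ {A : ZSet N} n {x z} → nfold n A x → z ≗ x → nfold n A z
nfold-≗ zero x≗0 z≗x j = trans (z≗x j) (x≗0 j)
nfold-≗ (suc n) (u , w , u∈ , w∈ , x≗) z≗x = u , w , u∈ , w∈ , λ j → trans (z≗x j) (x≗ j)

nfold-+⇐ : ∀ {A : ZSet N} l k → nfold k A ⊕ℤ nfold l A ⊆ nfold (l ℕ.+ k) A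
nfold-+⇐ zero k (x , y , x∈ , y≗0 , z≗) = nfold-≗ k x∈ λ j → trans (z≗ j) (trans (cong (λ s → x j ℤ.+ s) (y≗0 j)) (ℤP.+-identityʳ (x j)))
nfold-+⇐ (suc l) k (x , y , x∈ , (y' , w , y'∈ , w∈ , y≗) , z≗) =
  (λ j → x j ℤ.+ y' j) , w , nfold-+⇐ l k (x , y' , x∈ , y'∈ , λ _ → refl) , w∈ ,
  λ j → trans (z≗ j) (trans (cong (λ s → x j ℤ.+ s) (y≗ j)) (sym (ℤP.+-assoc (x j) (y' j) (w j))))

nfold-sum : ∀ {A : ZSet N} {k} (ns : Fin k → ℕ) (xs : Fin k → ZPt N) → (∀ i → nfold (ns i) A (xs i)) →
  nfold (ℕ∑.sum ns) A (sumZPt xs)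
nfold-sum {k = zero} ns xs _ _ = refl
nfold-sum {k = suc k} ns xs xs∈ =
  nfold-+⇐ (ns zero) (ℕ∑.sum (λ i → ns (suc i)))
    (sumZPt (λ i → xs (suc i)) , xs zero , nfold-sum (λ i → ns (suc i)) (λ i → xs (suc i)) (λ i → xs∈ (suc i)) , xs∈ zero ,
     λ j → ℤP.+-comm (xs zero j) _)

IDP⇒nfold : ∀ {S : RSet N} → IDP S → ∀ n → LP (scale n S) ⊆ nfold n (LP S)
IDP⇒nfold idp zero z∈ k = ιℤ-injective (scale-zero z∈ k)
IDP⇒nfold idp (suc n) {z} z∈ with Equivalence.to (idp (suc n) (s≤s z≤n) z) z∈
... | u , w , u∈ , w∈ , z≗ = u , w , IDP⇒nfold idp n u∈ , w∈ , z≗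

IDP-intro : ∀ {S : RSet N} → (∀ k → scale k S ⊕ S ⊆ scale (suc k) S) →
  (∀ k → LP (scale (suc k) S) ⊆ LP (scale k S) ⊕ℤ LP S) → IDP S
IDP-intro convex decompose (suc k) _ z = mk⇔ (decompose k) (λ z∈ → convex k (LP-⊕ℤ z∈))

scale-one⇐ : ∀ {S : RSet N} → S ⊆ scale 1 S
scale-one⇐ {x = x} x∈ = x , x∈ , λ j → sym (*-identityˡ (x j))

module _ {v : ZPt N} {V : List (ZPt N)} where

  scale-conv-⊕ : ∀ k l → scale k (conv (v ∷ V)) ⊕ scale l (conv (v ∷ V)) ⊆ scale (l ℕ.+ k) (conv (v ∷ V))
  scale-conv-⊕ k l (y , w , y∈ , w∈ , x≗) =
    scale-conv⇐ (l ℕ.+ k) (Comb-≗ (Comb-≡ (Comb-+ +-mono-≤ (scale-conv⇒ k y∈) (scale-conv⇒ l w∈))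
      (trans (+-comm (ιℕ k) (ιℕ l)) (sym (ιℕ-+ l k)))) x≗)

  nfold⊆scale-conv : ∀ n → nfold n (LP (conv (v ∷ V))) ⊆ LP (scale n (conv (v ∷ V)))
  nfold⊆scale-conv zero z≗0 = scale-conv⇐ 0 (Comb-≗ (Comb-origin (v ∷ V)) λ k → cong ιℤ (z≗0 k))
  nfold⊆scale-conv (suc n) z∈ =
    scale-conv-⊕ n 1 (LP-⊕ℤ (⊕ℤ-mono (nfold⊆scale-conv n) (λ {w} w∈ → scale-one⇐ {x = ι w} w∈) z∈))

  IDP-split : IDP (conv (v ∷ V)) → ∀ l k →
    LP (scale (l ℕ.+ k) (conv (v ∷ V))) ⊆ LP (scale k (conv (v ∷ V))) ⊕ℤ LP (scale l (conv (v ∷ V)))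
  IDP-split idp l k z∈ = ⊕ℤ-mono (nfold⊆scale-conv k) (nfold⊆scale-conv l) (nfold-+⇒ l k (IDP⇒nfold idp (l ℕ.+ k) z∈))

  IDP-conv : (∀ k → LP (scale (suc k) (conv (v ∷ V))) ⊆ LP (scale k (conv (v ∷ V))) ⊕ℤ LP (conv (v ∷ V))) →
    IDP (conv (v ∷ V))
  IDP-conv = IDP-intro (λ k → λ x∈ → scale-conv-⊕ k 1 (⊕-mono (λ y∈ → y∈) scale-one⇐ x∈))

-- The Cayley sum

unit-diag : ∀ (i : Fin m) → unit i i ≡ ℤ.+ 1
unit-diag i with i ≟ i
... | yes _ = refl
... | no i≢i = contradiction refl i≢i

unit-offdiag : ∀ {i j : Fin m} → i ≢ j → unit i j ≡ ℤ.+ 0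
unit-offdiag {i = i} {j} i≢j with i ≟ j
... | yes i≡j = contradiction i≡j i≢j
... | no _ = refl

unit-suc : ∀ (j i : Fin m) → unit (suc j) (suc i) ≡ unit j i
unit-suc j i = by-cases (j ≟ i)
  where
  by-cases : Dec (j ≡ i) → unit (suc j) (suc i) ≡ unit j i
  by-cases (yes refl) = trans (unit-diag (suc j)) (sym (unit-diag j))
  by-cases (no j≢i) = trans (unit-offdiag (λ sj≡si → j≢i (suc-injective sj≡si))) (sym (unit-offdiag j≢i))

ℕ∑≡1⇒unit : ∀ (a : Fin m → ℕ) → ℕ∑.sum a ≡ 1 → ∃[ j ] ∀ i → ℤ.+ a i ≡ unit j i
ℕ∑≡1⇒unit {m = suc m} a Σa≡1 with a zero in a₀≡
... | zero = let j , a≗ = ℕ∑≡1⇒unit (λ i → a (suc i)) Σa≡1 in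
  suc j , λ { zero → trans (cong ℤ.+_ a₀≡) (sym (unit-offdiag {i = suc j} {zero} (λ ()))) ; (suc i) → trans (a≗ i) (sym (unit-suc j i)) }
... | suc zero = zero , λ { zero → trans (cong ℤ.+_ a₀≡) (sym (unit-diag {m = suc m} zero))
                          ; (suc i) → trans (cong ℤ.+_ (ℕ∑≡0 (λ i → a (suc i)) (ℕP.suc-injective Σa≡1) i)) (sym (unit-offdiag {i = zero} {suc i} (λ ()))) }
  where
  ℕ∑≡0 : ∀ {m} (a : Fin m → ℕ) → ℕ∑.sum a ≡ 0 → ∀ i → a i ≡ 0
  ℕ∑≡0 a Σa≡0 zero = ℕP.m+n≡0⇒m≡0 (a zero) Σa≡0
  ℕ∑≡0 a Σa≡0 (suc i) = ℕ∑≡0 (λ i → a (suc i)) (ℕP.m+n≡0⇒n≡0 (a zero) Σa≡0) i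

unit-sym : ∀ (i j : Fin m) → unit i j ≡ unit j i
unit-sym i j = by-cases (i ≟ j)
  where
  by-cases : Dec (i ≡ j) → unit i j ≡ unit j i
  by-cases (yes refl) = refl
  by-cases (no i≢j) = trans (unit-offdiag i≢j) (sym (unit-offdiag (λ j≡i → i≢j (sym j≡i))))

ℚ∑-unit : ∀ (ts : Fin m → ℚ) j → ℚ∑.sum (λ i → ts i * ιℤ (unit i j)) ≡ ts j
ℚ∑-unit ts j = trans (ℚ∑-single _ j (λ i i≢j → trans (cong (λ u → ts i * ιℤ u) (unit-offdiag i≢j)) (*-zeroʳ (ts i))))
  (trans (cong (λ u → ts j * ιℤ u) (unit-diag j)) (*-identityʳ (ts j)))

ℤ∑-unit : ∀ (j : Fin m) (f : Fin m → ℤ) → ℤ∑.sum (λ i → unit j i ℤ.* f i) ≡ f j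
ℤ∑-unit j f =
  trans (ℤ∑-single _ j (λ i i≢j → trans (cong (λ u → u ℤ.* f i) (unit-offdiag (λ j≡i → i≢j (sym j≡i)))) (ℤP.*-zeroˡ (f i))))
    (trans (cong (λ u → u ℤ.* f j) (unit-diag j)) (ℤP.*-identityˡ (f j)))

module _ {R : ℚ → Set} where

  Comb-++⇒ : ∀ (V W : List (ZPt N)) {t} → Comb R (V ++ W) t ⊆ λ x → ∃[ s ] ∃[ u ] t ≡ s + u × (Comb R V s ⊕ Comb R W u) x
  Comb-++⇒ [] W {t} {x} x∈ = 0ℚ , t , sym (+-identityˡ t) , (λ _ → 0ℚ) , x , comb tt tt refl (λ _ → refl) , x∈ ,
    λ j → sym (+-identityˡ (x j))
  Comb-++⇒ (v ∷ V) W (comb (c , cs) (p , ps) refl x≗) with Comb-++⇒ V W (comb cs ps refl (λ _ → refl))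
  ... | s , u , w≡s+u , y , z , comb ds qs refl y≗ , z∈ , yz≗ =
    c + s , u , trans (cong (c +_) w≡s+u) (sym (+-assoc c s u)) ,
    (λ j → c * ιℤ (v j) + y j) , z , comb (c , ds) (p , qs) refl (λ j → cong (c * ιℤ (v j) +_) (y≗ j)) , z∈ ,
    λ j → trans (x≗ j) (trans (cong (c * ιℤ (v j) +_) (yz≗ j)) (sym (+-assoc (c * ιℤ (v j)) (y j) (z j))))

  Comb-++⇐ : ∀ (V W : List (ZPt N)) {s u y z} → Comb R V s y → Comb R W u z → Comb R (V ++ W) (s + u) (λ j → y j + z j)
  Comb-++⇐ [] W {s} {u} {y} {z} (comb _ _ refl y≗) z∈ =
    Comb-≗ (Comb-≡ z∈ (sym (+-identityˡ u))) λ j → trans (cong (_+ z j) (y≗ j)) (+-identityˡ (z j))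
  Comb-++⇐ (v ∷ V) W {u = u} {y} {z} (comb (c , cs) (p , ps) refl y≗) z∈ with Comb-++⇐ V W (comb cs ps refl (λ _ → refl)) z∈
  ... | comb ds qs w≡ yz≗ =
    comb (c , ds) (p , qs) (trans (cong (c +_) w≡) (sym (+-assoc c (weight V cs) u)))
      λ j → trans (cong (_+ z j) (y≗ j)) (trans (+-assoc (c * ιℤ (v j)) _ (z j)) (cong (c * ιℤ (v j) +_) (yz≗ j)))

  Comb-concat⇒ : ∀ {k} (B : Fin k → List (ZPt N)) {t} →
    Comb R (concat (tabulate B)) t ⊆ λ x → ∃[ ts ] t ≡ ℚ∑.sum ts × ΣRᶠ (λ i → Comb R (B i) (ts i)) x
  Comb-concat⇒ {k = zero} B (comb _ _ w x≗) = (λ ()) , sym w , (λ ()) , (λ ()) , x≗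
  Comb-concat⇒ {k = suc k} B x∈ with Comb-++⇒ (B zero) (concat (tabulate (λ i → B (suc i)))) x∈
  ... | s , u , t≡s+u , y , z , y∈ , z∈ , x≗ with Comb-concat⇒ (λ i → B (suc i)) z∈
  ... | ts , u≡Σts , zs , zs∈ , z≗ =
    (λ { zero → s ; (suc i) → ts i }) , trans t≡s+u (cong (s +_) u≡Σts) ,
    (λ { zero → y ; (suc i) → zs i }) , (λ { zero → y∈ ; (suc i) → zs∈ i }) , λ j → trans (x≗ j) (cong (y j +_) (z≗ j))

  Comb-concat⇐ : ∀ {k} (B : Fin k → List (ZPt N)) ts → ΣRᶠ (λ i → Comb R (B i) (ts i)) ⊆ Comb R (concat (tabulate B)) (ℚ∑.sum ts)
  Comb-concat⇐ {k = zero} B ts (_ , _ , x≗) = comb tt tt refl x≗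
  Comb-concat⇐ {k = suc k} B ts (xs , xs∈ , x≗) =
    Comb-≗ (Comb-++⇐ (B zero) (concat (tabulate (λ i → B (suc i)))) (xs∈ zero)
      (Comb-concat⇐ (λ i → B (suc i)) (λ i → ts (suc i)) ((λ i → xs (suc i)) , (λ i → xs∈ (suc i)) , λ _ → refl))) x≗


Comb-unit-weighted : ∀ (Vs : Fin m → List (ZPt N)) j {q : ZPt N} → Comb (0ℚ ≤_) (Vs j) 1ℚ (ι q) →
  ∀ i → Comb (0ℚ ≤_) (Vs i) (ιℤ (unit j i)) (ι (λ k → unit j i ℤ.* q k))
Comb-unit-weighted Vs j {q} q∈ i = by-cases (j ≟ i)
  where
  by-cases : Dec (j ≡ i) → Comb (0ℚ ≤_) (Vs i) (ιℤ (unit j i)) (ι (λ k → unit j i ℤ.* q k))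
  by-cases (yes refl) = Comb-≗ (Comb-≡ q∈ (cong ιℤ (sym (unit-diag j))))
    λ k → cong ιℤ (trans (cong (λ u → u ℤ.* q k) (unit-diag j)) (ℤP.*-identityˡ (q k)))
  by-cases (no j≢i) = Comb-≗ (Comb-≡ (Comb-origin (Vs i)) (cong ιℤ (sym (unit-offdiag j≢i))))
    λ k → cong ιℤ (trans (cong (λ u → u ℤ.* q k) (unit-offdiag j≢i)) (ℤP.*-zeroˡ (q k)))

module Split (m N : ℕ) where

  module _ {A : Set} where

    hd : Vector A (m ℕ.+ N) → Vector A m
    hd x i = x (i ↑ˡ N)

    tl : Vector A (m ℕ.+ N) → Vector A N
    tl x k = x (m ↑ʳ k)

    hd-tl-ext : ∀ {x y : Vector A (m ℕ.+ N)} → (∀ i → hd x i ≡ hd y i) → (∀ k → tl x k ≡ tl y k) → x ≗ y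
    hd-tl-ext hd≗ tl≗ j with splitAt m j | join-splitAt m N j
    ... | inj₁ i | refl = hd≗ i
    ... | inj₂ k | refl = tl≗ k

  module _ {R : ℚ → Set} (e : ZPt m) where

    Comb-lift⇒ : ∀ (V : List (ZPt N)) {t x} → Comb R (map (e Vector.++_) V) t x →
      (∀ i → hd x i ≡ t * ιℤ (e i)) × Comb R V t (tl x)
    Comb-lift⇒ [] (comb _ _ refl x≗) = (λ i → trans (x≗ _) (sym (*-zeroˡ (ιℤ (e i))))) , comb tt tt refl (λ k → x≗ _)
    Comb-lift⇒ (v ∷ V) (comb (c , cs) (p , ps) refl x≗) with Comb-lift⇒ V (comb cs ps refl (λ _ → refl))
    ... | hd≗ , comb ds qs w≡ tl≗ =
      (λ i → trans (x≗ _) (trans (cong₂ (λ a b → c * ιℤ a + b) (lookup-++ˡ e v i) (hd≗ i)) (sym (*-distribʳ-+ (ιℤ (e i)) c _)))) ,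
      comb (c , ds) (p , qs) (cong (c +_) w≡) λ k → trans (x≗ _) (cong₂ (λ a b → c * ιℤ a + b) (lookup-++ʳ e v k) (tl≗ k))

    Comb-lift⇐ : ∀ (V : List (ZPt N)) {t x} → (∀ i → hd x i ≡ t * ιℤ (e i)) → Comb R V t (tl x) →
      Comb R (map (e Vector.++_) V) t x
    Comb-lift⇐ [] hd≗ (comb _ _ refl tl≗) = comb tt tt refl (hd-tl-ext (λ i → trans (hd≗ i) (*-zeroˡ (ιℤ (e i)))) tl≗)
    Comb-lift⇐ (v ∷ V) {x = x} hd≗ (comb (c , cs) (p , ps) refl tl≗) =
      comb (c , ds) (p , qs) (cong (c +_) w≡) (hd-tl-ext
        (λ i → trans (hd≗ i) (trans (*-distribʳ-+ (ιℤ (e i)) c (weight V cs))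
          (cong₂ (λ a b → c * ιℤ a + b) (sym (lookup-++ˡ e v i)) (trans (sym (lookup-++ˡ e′ y′ i)) (x′≗ _)))))
        (λ k → trans (tl≗ k) (cong₂ (λ a b → c * ιℤ a + b) (sym (lookup-++ʳ e v k)) (trans (sym (lookup-++ʳ e′ y′ k)) (x′≗ _)))))
      where
      e′ : Fin m → ℚ
      e′ i = weight V cs * ιℤ (e i)
      y′ : Pt N
      y′ = combination V cs
      open Comb (Comb-lift⇐ V {x = e′ Vector.++ y′} (lookup-++ˡ e′ y′) (comb cs ps refl (lookup-++ʳ e′ y′)))
        renaming (coeffs to ds; coeffs-∈ to qs; weight≡ to w≡; point≗ to x′≗)

module _ (Vs : Fin m → List (ZPt N)) (ts : Fin m → ℚ) (j : Fin m) (off : ∀ i → i ≢ j → ts i ≡ 0ℚ) where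

  ΣRᶠ-single⇒ : ΣRᶠ (λ i → Comb (0ℚ ≤_) (Vs i) (ts i)) ⊆ Comb (0ℚ ≤_) (Vs j) (ts j)
  ΣRᶠ-single⇒ (ys , ys∈ , y≗) =
    Comb-≗ (ys∈ j) λ k → trans (y≗ k) (ℚ∑-single (λ i → ys i k) j (λ i i≢j → Comb-zero (Comb-≡ (ys∈ i) (off i i≢j)) k))

  ΣRᶠ-single⇐ : Comb (0ℚ ≤_) (Vs j) (ts j) ⊆ ΣRᶠ (λ i → Comb (0ℚ ≤_) (Vs i) (ts i))
  ΣRᶠ-single⇐ {y} y∈ = (λ i → ys i (i ≟ j)) , (λ i → ys∈ i (i ≟ j)) ,
    λ k → sym (trans (ℚ∑-single (λ i → ys i (i ≟ j) k) j (λ i i≢j → ys-off i (i ≟ j) i≢j k)) (ys-on (j ≟ j) k))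
    where
    ys : ∀ i → Dec (i ≡ j) → Pt N
    ys i (yes _) = y
    ys i (no _) = λ _ → 0ℚ
    ys∈ : ∀ i (i≟j : Dec (i ≡ j)) → Comb (0ℚ ≤_) (Vs i) (ts i) (ys i i≟j)
    ys∈ i (yes refl) = y∈
    ys∈ i (no i≢j) = Comb-≡ (Comb-origin (Vs i)) (sym (off i i≢j))
    ys-on : ∀ (j≟j : Dec (j ≡ j)) → ys j j≟j ≗ y
    ys-on (yes _) k = refl
    ys-on (no j≢j) k = contradiction refl j≢j
    ys-off : ∀ i (i≟j : Dec (i ≡ j)) → i ≢ j → ys i i≟j ≗ (λ _ → 0ℚ)
    ys-off i (yes i≡j) i≢j = contradiction i≡j i≢j
    ys-off i (no _) _ k = refl

-- The heads n eⱼ of the face {n eⱼ} × n Pⱼ of n C.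
faceHeads : ℕ → Fin m → Fin m → ℤ
faceHeads n j k = ℤ.+ n ℤ.* unit j k

private
  faceHeads-off : ∀ n (j k : Fin m) → k ≢ j → ιℤ (faceHeads n j k) ≡ 0ℚ
  faceHeads-off n j k k≢j = cong ιℤ (trans (cong (λ u → ℤ.+ n ℤ.* u) (unit-offdiag (λ j≡k → k≢j (sym j≡k)))) (ℤP.*-zeroʳ (ℤ.+ n)))

  faceHeads-on : ∀ n (j : Fin m) → ιℤ (faceHeads n j j) ≡ ιℕ n
  faceHeads-on n j = cong ιℤ (trans (cong (λ u → ℤ.+ n ℤ.* u) (unit-diag j)) (ℤP.*-identityʳ (ℤ.+ n)))

-- At coordinate i the left side vanishes unless i = j, while the right side is at least 1.
faceHeads-split : ∀ {n} {i j : Fin m} (a : Fin m → ℕ) → (∀ l → faceHeads (suc n) j l ≡ ℤ.+ a l ℤ.+ unit i l) →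
  i ≡ j × (∀ l → ℤ.+ a l ≡ faceHeads n j l)
faceHeads-split {n = n} {i} {j} a split = i≡j , λ l → ℤ-+-cancelʳ (unit j l) (ℤ.+ a l) (faceHeads n j l) (begin
  ℤ.+ a l ℤ.+ unit j l          ≡⟨ cong (λ i′ → ℤ.+ a l ℤ.+ unit i′ l) i≡j ⟨
  ℤ.+ a l ℤ.+ unit i l          ≡⟨ split l ⟨
  faceHeads (suc n) j l         ≡⟨ ℤP.*-distribʳ-+ (unit j l) (ℤ.+ 1) (ℤ.+ n) ⟩
  ℤ.+ 1 ℤ.* unit j l ℤ.+ faceHeads n j l ≡⟨ ℤP.+-comm (ℤ.+ 1 ℤ.* unit j l) (faceHeads n j l) ⟩
  faceHeads n j l ℤ.+ ℤ.+ 1 ℤ.* unit j l ≡⟨ cong (λ u → faceHeads n j l ℤ.+ u) (ℤP.*-identityˡ (unit j l)) ⟩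
  faceHeads n j l ℤ.+ unit j l  ∎)
  where
  open ≡-Reasoning
  i≡j : i ≡ j
  i≡j with i ≟ j
  ... | yes i≡j = i≡j
  ... | no i≢j = contradiction (trans (ℕP.+-comm 1 (a i)) (sym (ℤP.+-injective 0≡a+1))) ℕP.1+n≢0
    where
    0≡a+1 : ℤ.+ 0 ≡ ℤ.+ a i ℤ.+ ℤ.+ 1
    0≡a+1 = trans (sym (trans (cong (λ u → ℤ.+ suc n ℤ.* u) (unit-offdiag (λ j≡i → i≢j (sym j≡i)))) (ℤP.*-zeroʳ (ℤ.+ suc n))))
              (trans (split i) (cong (λ u → ℤ.+ a i ℤ.+ u) (unit-diag i)))

module CayleySum (P : Fin m → Poly N) where

  open Split m N public

  V : Fin m → List (ZPt N)
  V i = toList (P i)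

  block : Fin m → List (ZPt (m ℕ.+ N))
  block i = map (unit i Vector.++_) (V i)

  cayleyVerts≡concat : cayleyVerts P ≡ concat (tabulate block)
  cayleyVerts≡concat = cong concat (map-tabulate (λ i → i) block)

  module _ {R : ℚ → Set} where

    cayley-fiber⇒ : ∀ {t x} → Comb R (cayleyVerts P) t x →
      t ≡ ℚ∑.sum (hd x) × ΣRᶠ (λ i → Comb R (V i) (hd x i)) (tl x)
    cayley-fiber⇒ {t} {x} x∈ = from-blocks (Comb-concat⇒ block (subst (λ W → Comb R W t x) cayleyVerts≡concat x∈))
      where
      from-blocks : (∃[ ts ] t ≡ ℚ∑.sum ts × ΣRᶠ (λ i → Comb R (block i) (ts i)) x) →
        t ≡ ℚ∑.sum (hd x) × ΣRᶠ (λ i → Comb R (V i) (hd x i)) (tl x)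
      from-blocks (ts , t≡Σts , xs , xs∈ , x≗) =
        trans t≡Σts (ℚ∑.sum-cong-≗ (λ i → sym (hd≡ i))) ,
        (λ i → tl (xs i)) , (λ i → Comb-≡ (proj₂ (lifted i)) (sym (hd≡ i))) , λ k → x≗ (m ↑ʳ k)
        where
        lifted : ∀ i → (∀ i′ → hd (xs i) i′ ≡ ts i * ιℤ (unit i i′)) × Comb R (V i) (ts i) (tl (xs i))
        lifted i = Comb-lift⇒ (unit i) (V i) (xs∈ i)
        hd≡ : ∀ i → hd x i ≡ ts i
        hd≡ i = trans (x≗ (i ↑ˡ N)) (trans (ℚ∑.sum-cong-≗ (λ i′ → proj₁ (lifted i′) i)) (ℚ∑-unit ts i))

    cayley-fiber⇐ : ∀ {t x} ts → (∀ i → hd x i ≡ ts i) → t ≡ ℚ∑.sum ts →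
      ΣRᶠ (λ i → Comb R (V i) (ts i)) (tl x) → Comb R (cayleyVerts P) t x
    cayley-fiber⇐ {t} {x} ts hd≡ t≡Σts (ys , ys∈ , y≗) =
      subst (λ W → Comb R W t x) (sym cayleyVerts≡concat)
        (Comb-≗ (Comb-≡ (Comb-concat⇐ block ts (xs , xs∈ , λ _ → refl)) (sym t≡Σts))
          (hd-tl-ext (λ i → trans (hd≡ i) (sym (trans (ℚ∑.sum-cong-≗ (λ i′ → lookup-++ˡ (heads i′) (ys i′) i)) (ℚ∑-unit ts i))))
                     (λ k → trans (y≗ k) (sym (ℚ∑.sum-cong-≗ (λ i → lookup-++ʳ (heads i) (ys i) k))))))
      where
      heads : Fin m → Fin m → ℚ
      heads i i′ = ts i * ιℤ (unit i i′)
      xs : Fin m → Pt (m ℕ.+ N)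
      xs i = heads i Vector.++ ys i
      xs∈ : ∀ i → Comb R (block i) (ts i) (xs i)
      xs∈ i = Comb-lift⇐ (unit i) (V i) (lookup-++ˡ (heads i) (ys i)) (Comb-≗ (ys∈ i) (lookup-++ʳ (heads i) (ys i)))

  record LatticeFiber (R : ℚ → Set) (n : ℕ) (Z : ZPt (m ℕ.+ N)) : Set where
    field
      heads : Fin m → ℕ
      hd≡heads : ∀ i → hd Z i ≡ ℤ.+ heads i
      Σheads≡n : ℕ∑.sum heads ≡ n
      tl∈ : ΣRᶠ (λ i → Comb R (V i) (ιℕ (heads i))) (ι (tl Z))

  module _ {R : ℚ → Set} where

    cayley-lattice⇒ : ∀ {n Z} → (∀ {c} → R c → 0ℚ ≤ c) → Comb R (cayleyVerts P) (ιℕ n) (ι Z) → LatticeFiber R n Z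
    cayley-lattice⇒ {n} {Z} R⇒0≤ Z∈ = from-fiber (cayley-fiber⇒ Z∈)
      where
      from-fiber : ιℕ n ≡ ℚ∑.sum (hd (ι Z)) × ΣRᶠ (λ i → Comb R (V i) (hd (ι Z) i)) (tl (ι Z)) → LatticeFiber R n Z
      from-fiber (n≡Σhd , tl∈) = record
        { heads = a
        ; hd≡heads = hd≡a
        ; Σheads≡n = ιℕ-injective (trans (ιℕ-sum a) (trans (ℚ∑.sum-cong-≗ (λ i → cong ιℤ (sym (hd≡a i)))) (sym n≡Σhd)))
        ; tl∈ = ΣRᶠ-mono {Q = λ i → Comb R (V i) (hd (ι Z) i)} (λ i y∈ → Comb-≡ y∈ (cong ιℤ (hd≡a i))) tl∈
        }
        where
        natural : ∀ i → ∃[ k ] hd Z i ≡ ℤ.+ k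
        natural i = nonNeg-ιℤ⇒ℕ (hd Z i) (Comb-weight-nonNeg (Comb-mono R⇒0≤ (proj₁ (proj₂ tl∈) i)))
        a : Fin m → ℕ
        a i = proj₁ (natural i)
        hd≡a : ∀ i → hd Z i ≡ ℤ.+ a i
        hd≡a i = proj₂ (natural i)

    cayley-lattice⇐ : ∀ (h : Fin m → ℤ) (z : ZPt N) {t} → t ≡ ℚ∑.sum (λ i → ιℤ (h i)) →
      ΣRᶠ (λ i → Comb R (V i) (ιℤ (h i))) (ι z) → Comb R (cayleyVerts P) t (ι (h Vector.++ z))
    cayley-lattice⇐ h z t≡Σh (ys , ys∈ , y≗) =
      cayley-fiber⇐ (λ i → ιℤ (h i)) (λ i → cong ιℤ (lookup-++ˡ h z i)) t≡Σh
        (ys , ys∈ , λ k → trans (cong ιℤ (lookup-++ʳ h z k)) (y≗ k))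

  cayley-face⇒ : ∀ {n j t Z} → (∀ k → hd Z k ≡ faceHeads n j k) → Comb (0ℚ ≤_) (cayleyVerts P) t (ι Z) →
    Comb (0ℚ ≤_) (V j) (ιℕ n) (ι (tl Z))
  cayley-face⇒ {n} {j} {Z = Z} hd≡ Z∈ =
    Comb-≡ (ΣRᶠ-single⇒ V (λ k → ιℤ (hd Z k)) j (λ k k≢j → trans (cong ιℤ (hd≡ k)) (faceHeads-off n j k k≢j))
      (proj₂ (cayley-fiber⇒ Z∈))) (trans (cong ιℤ (hd≡ j)) (faceHeads-on n j))

  cayley-face⇐ : ∀ {n j z} → Comb (0ℚ ≤_) (V j) (ιℕ n) (ι z) →
    Comb (0ℚ ≤_) (cayleyVerts P) (ιℕ n) (ι (faceHeads n j Vector.++ z))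
  cayley-face⇐ {n} {j} {z} z∈ =
    cayley-lattice⇐ (faceHeads n j) z
      (sym (trans (ℚ∑-single _ j (faceHeads-off n j)) (faceHeads-on n j)))
      (ΣRᶠ-single⇐ V (λ k → ιℤ (faceHeads n j k)) j (faceHeads-off n j) (Comb-≡ z∈ (sym (faceHeads-on n j))))

  cayley-latticePoint : ∀ {W} → LP (Cayley P) W → ∃[ j ] (∀ i → hd W i ≡ unit j i) × LP ⟦ P j ⟧ (tl W)
  cayley-latticePoint {W} W∈ =
    let j , heads≡unit = ℕ∑≡1⇒unit heads Σheads≡n
        hd≡unit i = trans (hd≡heads i) (heads≡unit i)
    in j , hd≡unit , Comb⇒conv (cayley-face⇒ {n = 1} {Z = W} (λ i → trans (hd≡unit i) (sym (ℤP.*-identityˡ (unit j i)))) W∈′)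
    where
    W∈′ : Comb (0ℚ ≤_) (cayleyVerts P) 1ℚ (ι W)
    W∈′ = conv⇒Comb {V = cayleyVerts P} W∈
    open LatticeFiber (cayley-lattice⇒ {n = 1} {Z = W} (λ 0≤c → 0≤c) W∈′)

-- Integer decomposition property

restrictWeights : (Fin m → Bool) → (Fin m → ℕ) → Fin m → ℕ
restrictWeights I a i = if I i then a i else 0

restrictℤ⊆LP : ∀ I (Q : Fin m → RSet N) i → restrictℤ I (λ i → LP (Q i)) i ⊆ LP (restrict I Q i)
restrictℤ⊆LP I Q i with I i
... | true = λ z∈ → z∈
... | false = λ z≗0 k → cong ιℤ (z≗0 k)

TupleIDP-all : ∀ {Q : Fin (suc m) → RSet N} → TupleIDP Q → LP (ΣR Q) ⊆ ΣZ (λ i → LP (Q i))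
TupleIDP-all tuple {z} = Equivalence.to (tuple (λ _ → true) (zero , refl) z)

module _ (P : Fin (suc m) → Poly N) where

  open CayleySum P

  nfold-cayley : ∀ n {Z} → nfold n (LP (Cayley P)) Z → ΣZᶠ (λ i → LP (Comb (0ℚ ≤_) (V i) (ιℤ (hd Z i)))) (tl Z)
  nfold-cayley zero {Z} Z≗0 =
    (λ _ _ → ℤ.+ 0) , (λ i → Comb-≗ (Comb-≡ (Comb-origin (V i)) (cong ιℤ (sym (Z≗0 _)))) (λ _ → refl)) ,
    λ k → trans (Z≗0 _) (sym (ℤ∑.sum-replicate-zero (suc m)))
  nfold-cayley (suc n) {Z} (U , W , U∈ , W∈ , Z≗) = add-vertex (nfold-cayley n U∈) (cayley-latticePoint {W} W∈)
    where
    add-vertex : ΣZᶠ (λ i → LP (Comb (0ℚ ≤_) (V i) (ιℤ (hd U i)))) (tl U) →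
      ∃[ j ] (∀ i → hd W i ≡ unit j i) × LP ⟦ P j ⟧ (tl W) →
      ΣZᶠ (λ i → LP (Comb (0ℚ ≤_) (V i) (ιℤ (hd Z i)))) (tl Z)
    add-vertex (us , us∈ , tlU≗) (j , hdW≡ , q∈) = zs , zs∈ , tl≗
      where
      zs : Fin (suc m) → ZPt N
      zs i k = us i k ℤ.+ unit j i ℤ.* tl W k
      hdZ≡ : ∀ i → ιℤ (hd Z i) ≡ ιℤ (hd U i) + ιℤ (unit j i)
      hdZ≡ i = trans (cong ιℤ (Z≗ (i ↑ˡ N))) (trans (ιℤ-+ (hd U i) (hd W i)) (cong (λ u → ιℤ (hd U i) + ιℤ u) (hdW≡ i)))
      zs∈ : ∀ i → LP (Comb (0ℚ ≤_) (V i) (ιℤ (hd Z i))) (zs i)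
      zs∈ i = Comb-≗ (Comb-≡ (Comb-+ +-mono-≤ (us∈ i) (Comb-unit-weighted V j (conv⇒Comb q∈) i)) (sym (hdZ≡ i)))
        λ k → ιℤ-+ (us i k) (unit j i ℤ.* tl W k)
      tl≗ : ∀ k → tl Z k ≡ sumZPt zs k
      tl≗ k = begin
        tl Z k                                                 ≡⟨ Z≗ (suc m ↑ʳ k) ⟩
        tl U k ℤ.+ tl W k                                      ≡⟨ cong₂ ℤ._+_ (tlU≗ k) (sym (ℤ∑-unit j (λ _ → tl W k))) ⟩
        sumZPt us k ℤ.+ ℤ∑.sum (λ i → unit j i ℤ.* tl W k)     ≡⟨ ℤ∑.∑-distrib-+ (λ i → us i k) (λ i → unit j i ℤ.* tl W k) ⟨
        sumZPt zs k                                            ∎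
        where open ≡-Reasoning

  IDP-Cayley⇒IDP-summand : IDP (Cayley P) → ∀ j → IDP ⟦ P j ⟧
  IDP-Cayley⇒IDP-summand idpC j = IDP-conv decompose
    where
    decompose : ∀ k → LP (scale (suc k) ⟦ P j ⟧) ⊆ LP (scale k ⟦ P j ⟧) ⊕ℤ LP ⟦ P j ⟧
    decompose k {z} z∈ = on-face (Equivalence.to (idpC (suc k) (s≤s z≤n) Z) Z∈)
      where
      Z : ZPt (suc m ℕ.+ N)
      Z = faceHeads (suc k) j Vector.++ z
      Z∈ : LP (scale (suc k) (Cayley P)) Z
      Z∈ = scale-conv⇐ (suc k) (cayley-face⇐ {n = suc k} {j} (scale-conv⇒ (suc k) z∈))
      on-face : (LP (scale k (Cayley P)) ⊕ℤ LP (Cayley P)) Z → (LP (scale k ⟦ P j ⟧) ⊕ℤ LP ⟦ P j ⟧) z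
      on-face (U , W , U∈ , W∈ , Z≗) = from-vertex (cayley-latticePoint {W} W∈)
        where
        open LatticeFiber (cayley-lattice⇒ {n = k} {Z = U} (λ 0≤c → 0≤c) (scale-conv⇒ k U∈))
        on-vertex : ∀ {i} → i ≡ j × (∀ l → ℤ.+ heads l ≡ faceHeads k j l) → LP ⟦ P i ⟧ (tl W) →
          (LP (scale k ⟦ P j ⟧) ⊕ℤ LP ⟦ P j ⟧) z
        on-vertex (refl , heads≡) q∈ =
          tl U , tl W , scale-conv⇐ k (cayley-face⇒ {n = k} {j} {Z = U} (λ l → trans (hd≡heads l) (heads≡ l)) (scale-conv⇒ k U∈)) ,
          q∈ , λ l → trans (sym (lookup-++ʳ (faceHeads (suc k) j) z l)) (Z≗ (suc m ↑ʳ l))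
        from-vertex : ∃[ i ] (∀ l → hd W l ≡ unit i l) × LP ⟦ P i ⟧ (tl W) → (LP (scale k ⟦ P j ⟧) ⊕ℤ LP ⟦ P j ⟧) z
        from-vertex (i , hdW≡ , q∈) =
          on-vertex (faceHeads-split {n = k} heads λ l → trans (sym (lookup-++ˡ (faceHeads (suc k) j) z l))
                                                   (trans (Z≗ (l ↑ˡ N)) (cong₂ ℤ._+_ (hd≡heads l) (hdW≡ l)))) q∈

  IDP-Cayley⇒TupleIDP : IDP (Cayley P) → ∀ a → TupleIDP (λ i → scale (a i) ⟦ P i ⟧)
  IDP-Cayley⇒TupleIDP idpC a I _ z =
    mk⇔ to (λ z∈ → ΣZ⊆LPΣR {Q = restrict I Q} (ΣZ-mono {B = λ i → LP (restrict I Q i)} (restrictℤ⊆LP I Q) z∈))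
    where
    Q : Fin (suc m) → RSet N
    Q i = scale (a i) ⟦ P i ⟧
    b : Fin (suc m) → ℕ
    b = restrictWeights I a
    restrict⊆Comb : ∀ i → restrict I Q i ⊆ Comb (0ℚ ≤_) (V i) (ιℕ (b i))
    restrict⊆Comb i with I i
    ... | true = scale-conv⇒ (a i)
    ... | false = λ x≗0 → Comb-≗ (Comb-origin (V i)) x≗0
    Comb⊆restrictℤ : ∀ i → LP (Comb (0ℚ ≤_) (V i) (ιℕ (b i))) ⊆ restrictℤ I (λ i → LP (Q i)) i
    Comb⊆restrictℤ i with I i
    ... | true = scale-conv⇐ (a i)
    ... | false = λ z∈ k → ιℤ-injective (Comb-zero z∈ k)
    Z : ZPt (suc m ℕ.+ N)
    Z = (λ i → ℤ.+ b i) Vector.++ z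
    to : LP (ΣR (restrict I Q)) z → ΣZ (restrictℤ I (λ i → LP (Q i))) z
    to z∈ = from-fiber (nfold-cayley (ℕ∑.sum b) {Z} (IDP⇒nfold idpC (ℕ∑.sum b) Z∈))
      where
      Z∈ : LP (scale (ℕ∑.sum b) (Cayley P)) Z
      Z∈ = scale-conv⇐ (ℕ∑.sum b) (cayley-lattice⇐ (λ i → ℤ.+ b i) z (ιℕ-sum b)
             (ΣRᶠ-mono {Q = restrict I Q} restrict⊆Comb (ΣR⊆ΣRᶠ {Q = restrict I Q} z∈)))
      from-fiber : ΣZᶠ (λ i → LP (Comb (0ℚ ≤_) (V i) (ιℤ (hd Z i)))) (tl Z) → ΣZ (restrictℤ I (λ i → LP (Q i))) z
      from-fiber (zs , zs∈ , tl≗) = ΣZᶠ⊆ΣZ {A = restrictℤ I (λ i → LP (Q i))}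
        (zs , (λ i → Comb⊆restrictℤ i (Comb-≡ (zs∈ i) (cong ιℤ (lookup-++ˡ (λ i → ℤ.+ b i) z i)))) ,
         λ k → trans (sym (lookup-++ʳ (λ i → ℤ.+ b i) z k)) (tl≗ k))

  nfold-face : ∀ j k {z} → nfold k (LP ⟦ P j ⟧) z → nfold k (LP (Cayley P)) (faceHeads k j Vector.++ z)
  nfold-face j zero {z} z≗0 =
    hd-tl-ext {y = λ _ → ℤ.+ 0} (λ i → trans (lookup-++ˡ (faceHeads 0 j) z i) (ℤP.*-zeroˡ (unit j i)))
              (λ l → trans (lookup-++ʳ (faceHeads 0 j) z l) (z≗0 l))
  nfold-face j (suc k) {z} (u , w , u∈ , w∈ , z≗) =
    faceHeads k j Vector.++ u , faceHeads 1 j Vector.++ w , nfold-face j k u∈ ,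
    Comb⇒conv (cayley-face⇐ {n = 1} {j} (conv⇒Comb w∈)) ,
    hd-tl-ext (λ i → trans (lookup-++ˡ (faceHeads (suc k) j) z i)
                (trans (ℤP.*-distribʳ-+ (unit j i) (ℤ.+ 1) (ℤ.+ k))
                  (trans (ℤP.+-comm (faceHeads 1 j i) (faceHeads k j i))
                    (sym (cong₂ ℤ._+_ (lookup-++ˡ (faceHeads k j) u i) (lookup-++ˡ (faceHeads 1 j) w i))))))
              (λ l → trans (lookup-++ʳ (faceHeads (suc k) j) z l)
                (trans (z≗ l) (sym (cong₂ ℤ._+_ (lookup-++ʳ (faceHeads k j) u l) (lookup-++ʳ (faceHeads 1 j) w l)))))

  IDP-summands⇒IDP-Cayley : (∀ i → IDP ⟦ P i ⟧) → (∀ a → TupleIDP (λ i → scale (a i) ⟦ P i ⟧)) → IDP (Cayley P)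
  IDP-summands⇒IDP-Cayley idpP tuple = IDP-conv decompose
    where
    decompose : ∀ n → LP (scale (suc n) (Cayley P)) ⊆ LP (scale n (Cayley P)) ⊕ℤ LP (Cayley P)
    decompose n {Z} Z∈ =
      ⊕ℤ-mono (nfold⊆scale-conv n) (λ W∈ → W∈)
        (subst (λ k → nfold k (LP (Cayley P)) Z) Σheads≡n (as-nfold (ΣZ⊆ΣZᶠ {A = λ i → LP (Q i)} (TupleIDP-all {Q = Q} (tuple heads) tl∈′))))
      where
      open LatticeFiber (cayley-lattice⇒ {n = suc n} {Z = Z} (λ 0≤c → 0≤c) (scale-conv⇒ (suc n) Z∈))
      Q : Fin (suc m) → RSet N
      Q i = scale (heads i) ⟦ P i ⟧
      tl∈′ : LP (ΣR Q) (tl Z)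
      tl∈′ = ΣRᶠ⊆ΣR {Q = Q} (ΣRᶠ-mono {Q' = Q} (λ i → scale-conv⇐ (heads i)) tl∈)
      -- Each summand is a sum of (heads i) lattice points of P i, each of which lifts to a lattice point of C.
      as-nfold : ΣZᶠ (λ i → LP (Q i)) (tl Z) → nfold (ℕ∑.sum heads) (LP (Cayley P)) Z
      as-nfold (zs , zs∈ , tl≗) =
        nfold-≗ (ℕ∑.sum heads) (nfold-sum heads lifts (λ i → nfold-face i (heads i) (IDP⇒nfold (idpP i) (heads i) (zs∈ i))))
          (hd-tl-ext (λ l → trans (hd≡heads l) (sym (trans (ℤ∑.sum-cong-≗ (lifts-hd l)) (ℤ∑-unit l (λ i → ℤ.+ heads i)))))
                     (λ k → trans (tl≗ k) (ℤ∑.sum-cong-≗ (λ i → sym (lookup-++ʳ (faceHeads (heads i) i) (zs i) k)))))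
        where
        lifts : Fin (suc m) → ZPt (suc m ℕ.+ N)
        lifts i = faceHeads (heads i) i Vector.++ zs i
        lifts-hd : ∀ l i → lifts i (l ↑ˡ N) ≡ unit l i ℤ.* ℤ.+ heads i
        lifts-hd l i = trans (lookup-++ˡ (faceHeads (heads i) i) (zs i) l)
          (trans (ℤP.*-comm (ℤ.+ heads i) (unit i l)) (cong (λ u → u ℤ.* ℤ.+ heads i) (unit-sym i l)))

  IDP-summands⇒IDP-Minkowski : (∀ i → IDP ⟦ P i ⟧) → (∀ a → TupleIDP (λ i → scale (a i) ⟦ P i ⟧)) →
    ∀ a → IDP (ΣR (λ i → scale (a i) ⟦ P i ⟧))
  IDP-summands⇒IDP-Minkowski idpP tuple a = IDP-intro convex decompose
    where
    S : RSet N
    S = ΣR (λ i → scale (a i) ⟦ P i ⟧)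
    dilated : ℕ → Fin (suc m) → RSet N
    dilated k i = scale (k ℕ.* a i) ⟦ P i ⟧
    convex : ∀ k → scale k S ⊕ S ⊆ scale (suc k) S
    convex k x∈ = scale-ΣR-scale⇐ {Q = λ i → ⟦ P i ⟧} a (suc k)
      (ΣR-mono {Q' = dilated (suc k)} (λ i → scale-conv-⊕ (k ℕ.* a i) (a i))
        (ΣR-⊕ {A = dilated k} {λ i → scale (a i) ⟦ P i ⟧} (⊕-mono (scale-ΣR-scale⇒ {Q = λ i → ⟦ P i ⟧} a k) (λ y∈ → y∈) x∈)))
    decompose : ∀ k → LP (scale (suc k) S) ⊆ LP (scale k S) ⊕ℤ LP S
    decompose k {z} z∈ =
      ⊕ℤ-mono (λ u∈ → scale-ΣR-scale⇐ {Q = λ i → ⟦ P i ⟧} a k (ΣZ⊆LPΣR {Q = dilated k} u∈)) (ΣZ⊆LPΣR {Q = λ i → scale (a i) ⟦ P i ⟧})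
        (ΣZ-⊕ℤ {A = λ i → LP (dilated k i)} {λ i → LP (scale (a i) ⟦ P i ⟧)}
          (ΣZ-mono {A = λ i → LP (dilated (suc k) i)} {λ i → LP (dilated k i) ⊕ℤ LP (scale (a i) ⟦ P i ⟧)}
            (λ i → IDP-split (idpP i) (a i) (k ℕ.* a i))
            (TupleIDP-all {Q = dilated (suc k)} (tuple (λ i → suc k ℕ.* a i)) {z} (scale-ΣR-scale⇒ {Q = λ i → ⟦ P i ⟧} a (suc k) z∈))))

  -- Levelness

  ΣP : RSet N
  ΣP = ΣR (λ i → ⟦ P i ⟧)

  private
    scale-ΣP⇒ : ∀ n → scale n ΣP ⊆ ΣRᶠ (λ i → Comb (0ℚ ≤_) (V i) (ιℕ n))
    scale-ΣP⇒ n x∈ = ΣRᶠ-mono {Q = λ i → scale n ⟦ P i ⟧} (λ i → scale-conv⇒ n)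
      (ΣR⊆ΣRᶠ {Q = λ i → scale n ⟦ P i ⟧} (scale-ΣR⇒ {Q = λ i → ⟦ P i ⟧} n x∈))

    scale-ΣP⇐ : ∀ n → ΣRᶠ (λ i → Comb (0ℚ ≤_) (V i) (ιℕ n)) ⊆ scale n ΣP
    scale-ΣP⇐ n x∈ = scale-ΣR⇐ {Q = λ i → ⟦ P i ⟧} n
      (ΣRᶠ⊆ΣR {Q = λ i → scale n ⟦ P i ⟧} (ΣRᶠ-mono {Q' = λ i → scale n ⟦ P i ⟧} (λ i → scale-conv⇐ n) x∈))

    relint-scale-ΣP⇒ : ∀ n → relint (scale (suc n) ΣP) ⊆ ΣRᶠ (λ i → Comb (0ℚ <_) (V i) (ιℕ (suc n)))
    relint-scale-ΣP⇒ n x∈ =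
      relint⇒ΣRᶠ-pos P (λ _ → ιℕ (suc n)) (λ _ → ιℕ-pos n) (relint-cong (scale-ΣP⇒ (suc n)) (scale-ΣP⇐ (suc n)) x∈)

    relint-scale-ΣP⇐ : ∀ n → ΣRᶠ (λ i → Comb (0ℚ <_) (V i) (ιℕ n)) ⊆ relint (scale n ΣP)
    relint-scale-ΣP⇐ n x∈ = relint-cong (scale-ΣP⇐ n) (scale-ΣP⇒ n) (ΣRᶠ-pos⇒relint V (λ _ → ιℕ n) x∈)

    relint-scale-C⇒ : ∀ n → relint (scale (suc n) (Cayley P)) ⊆ Comb (0ℚ <_) (cayleyVerts P) (ιℕ (suc n))
    relint-scale-C⇒ n x∈ = relint⇒Comb-pos (ιℕ-pos n) (relint-cong (scale-conv⇒ (suc n)) (scale-conv⇐ (suc n)) x∈)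

    relint-scale-C⇐ : ∀ n → Comb (0ℚ <_) (cayleyVerts P) (ιℕ n) ⊆ relint (scale n (Cayley P))
    relint-scale-C⇐ n x∈ = relint-cong (scale-conv⇐ n) (scale-conv⇒ n) (Comb-pos⇒relint x∈)

  -- The heads are positive integers summing to m + 1, hence all equal to 1.
  relint-Cayley-lattice : ∀ {Z} → LP (relint (scale (suc m) (Cayley P))) Z →
    (∀ i → hd Z i ≡ ℤ.+ 1) × LP (relint (scale 1 ΣP)) (tl Z)
  relint-Cayley-lattice {Z} Z∈ =
    (λ i → trans (hd≡heads i) (cong ℤ.+_ (heads≡1 i))) ,
    relint-scale-ΣP⇐ 1 (ΣRᶠ-mono {Q = λ i → Comb (0ℚ <_) (V i) (ιℕ (heads i))} (λ i y∈ → Comb-≡ y∈ (cong ιℕ (heads≡1 i))) tl∈)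
    where
    open LatticeFiber (cayley-lattice⇒ {n = suc m} {Z = Z} <⇒≤ (relint-scale-C⇒ m Z∈))
    heads≡1 : ∀ i → heads i ≡ 1
    heads≡1 = ℕ∑≡m⇒all-one heads (λ i → ιℕ-pos⁻¹ (heads i) (Comb-weight-pos (proj₁ (proj₂ tl∈) i))) Σheads≡n

  Level-Cayley⇒Level-Minkowski : Level (Cayley P) (suc m) → Level ΣP 1
  Level-Cayley⇒Level-Minkowski (_ , (Z₀ , Z₀∈) , _ , decomposeC) =
    s≤s z≤n , (tl Z₀ , proj₂ (relint-Cayley-lattice {Z₀} Z₀∈)) , (λ t 1≤t t<1 _ _ → ℕP.<⇒≱ t<1 1≤t) ,
    λ { (suc k) _ z → mk⇔ (to k) (from k) }
    where
    to : ∀ k {z} → LP (relint (scale (suc k) ΣP)) z → (LP (relint (scale 1 ΣP)) ⊕ℤ LP (scale k ΣP)) z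
    to k {z} z∈ = split (Equivalence.to (decomposeC c (ℕP.m≤m*n (suc m) (suc k)) Z) Z∈)
      where
      c : ℕ
      c = suc m ℕ.* suc k
      Z : ZPt (suc m ℕ.+ N)
      Z = (λ _ → ℤ.+ suc k) Vector.++ z
      Z∈ : LP (relint (scale c (Cayley P))) Z
      Z∈ = relint-scale-C⇐ c (cayley-lattice⇐ (λ _ → ℤ.+ suc k) z
             (trans (cong ιℕ (sym (ℕ∑-const (suc m) (suc k)))) (ιℕ-sum {suc m} (λ _ → suc k))) (relint-scale-ΣP⇒ k z∈))
      split : (LP (relint (scale (suc m) (Cayley P))) ⊕ℤ LP (scale (c ℕ.∸ suc m) (Cayley P))) Z →
        (LP (relint (scale 1 ΣP)) ⊕ℤ LP (scale k ΣP)) z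
      split (Z₁ , Z₂ , Z₁∈ , Z₂∈ , Z≗) =
        tl Z₁ , tl Z₂ , proj₂ (relint-Cayley-lattice {Z₁} Z₁∈) ,
        scale-ΣP⇐ k (ΣRᶠ-mono {Q = λ i → Comb (0ℚ ≤_) (V i) (ιℕ (heads i))} (λ i y∈ → Comb-≡ y∈ (cong ιℕ (heads≡k i))) tl∈) ,
        λ l → trans (sym (lookup-++ʳ {m = suc m} (λ _ → ℤ.+ suc k) z l)) (Z≗ (suc m ↑ʳ l))
        where
        open LatticeFiber (cayley-lattice⇒ {n = c ℕ.∸ suc m} {Z = Z₂} (λ 0≤c → 0≤c) (scale-conv⇒ (c ℕ.∸ suc m) Z₂∈))
        heads≡k : ∀ i → heads i ≡ k
        heads≡k i = sym (ℕP.suc-injective (ℤP.+-injective (begin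
          ℤ.+ suc k            ≡⟨ lookup-++ˡ {m = suc m} (λ _ → ℤ.+ suc k) z i ⟨
          Z (i ↑ˡ N)           ≡⟨ Z≗ (i ↑ˡ N) ⟩
          hd Z₁ i ℤ.+ hd Z₂ i  ≡⟨ cong₂ ℤ._+_ (proj₁ (relint-Cayley-lattice {Z₁} Z₁∈) i) (hd≡heads i) ⟩
          ℤ.+ suc (heads i)    ∎)))
          where open ≡-Reasoning
    from : ∀ k {z} → (LP (relint (scale 1 ΣP)) ⊕ℤ LP (scale k ΣP)) z → LP (relint (scale (suc k) ΣP)) z
    from k (y , w , y∈ , w∈ , z≗) =
      let xs , xs∈ , x≗ = ΣRᶠ-Comb-+ V (λ _ → ιℕ 1) (λ _ → ιℕ k) +-mono-<-≤ (relint-scale-ΣP⇒ 0 y∈) (scale-ΣP⇒ k w∈)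
      in relint-scale-ΣP⇐ (suc k) (xs , (λ i → Comb-≡ (xs∈ i) (sym (ιℕ-+ 1 k))) ,
                                   λ j → trans (trans (cong ιℤ (z≗ j)) (ιℤ-+ (y j) (w j))) (x≗ j))

theorem0p4 : (N m : ℕ) → 1 ℕ.≤ m → (P : Fin m → Poly N) →
    (IDP (Cayley P) ⇔ ((∀ i → IDP ⟦ P i ⟧) × (∀ (a : Fin m → ℕ) → TupleIDP (λ i → scale (a i) ⟦ P i ⟧))))
    × (IDP (Cayley P) → ∀ (a : Fin m → ℕ) → IDP (ΣR (λ i → scale (a i) ⟦ P i ⟧)))
    × (Level (Cayley P) m → Level (ΣR (λ i → ⟦ P i ⟧)) 1)
theorem0p4 N (suc m) _ P = mk⇔ IDP-Cayley⇒ (λ (idpP , tuple) → IDP-summands⇒IDP-Cayley P idpP tuple) ,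
  (λ idpC → let idpP , tuple = IDP-Cayley⇒ idpC in IDP-summands⇒IDP-Minkowski P idpP tuple) ,
  Level-Cayley⇒Level-Minkowski P
  where
  IDP-Cayley⇒ : IDP (Cayley P) → (∀ i → IDP ⟦ P i ⟧) × (∀ (a : Fin (suc m) → ℕ) → TupleIDP (λ i → scale (a i) ⟦ P i ⟧))
  IDP-Cayley⇒ idpC = IDP-Cayley⇒IDP-summand P idpC , IDP-Cayley⇒TupleIDP P idpC
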